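{- For $n\ge1$ let $S_n(132)$ be the set of $132$-avoiding permutations of $\{1,\dots,n\}$, and for $\sigma=\sigma_1\cdots\sigma_n$ let $\mathrm{box}(\sigma)$ be the number of indices $i$ such that $|\sigma_i-\sigma_{i+1}|=1$ or $|\sigma_{i-1}-\sigma_i|=1$ (ignoring nonexistent entries). Let $A_0(x)=1$, $A_n(x)=\sum_{\sigma\in S_n(132)}x^{\mathrm{box}(\sigma)}$, $B_n(x)=\sum_{\sigma\in S_n(132),\sigma_1=n}x^{\mathrm{box}(\sigma)}$, $E_n(x)=\sum_{\sigma\in S_n(132),\sigma_n=n}x^{\mathrm{box}(\sigma)}$. Then for $n\le3$, $A_n(x)|_{x^4}=B_n(x)|_{x^4}=E_n(x)|_{x^4}=0$; $B_4(x)|_{x^4}=2$; $B_5(x)|_{x^4}=6$; for $n\ge4$, $$A_n(x)|_{x^4}=2B_n(x)|_{x^4}+B_{n-1}(x)|_{x^4}+\sum_{i=2}^{n-2}F_{i-2}F_{n-i};$$ and for $n\ge6$, $$B_n(x)|_{x^4}=B_{n-1}(x)|_{x^4}+B_{n-2}(x)|_{x^4}+F_{n-1}+\sum_{i=4}^{n-3}F_{i-2}F_{n-1-i}.$$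
   Context: A permutation $\sigma\in S_n$ avoids $132$ if there are no indices $i<j<k$ with $\sigma_i<\sigma_k<\sigma_j$. $P(x)|_{x^m}$ denotes the coefficient of $x^m$ in the polynomial $P(x)$. The Fibonacci numbers are defined by $F_0=F_1=1$ and $F_n=F_{n-1}+F_{n-2}$ for $n\ge2$. Empty sums are $0$. -}

module Defs where

open import Data.Nat using (ℕ; zero; suc; _+_; _*_; _∸_; _<ᵇ_; _≡ᵇ_; ∣_-_∣)
open import Data.Bool using (Bool; true; false; _∧_; _∨_; not; if_then_else_)
open import Data.List using (List; []; _∷_; _++_; map; concatMap; filter; length; upTo; foldr; replicate; head; last)
open import Data.Bool.ListAction using (any)
open import Data.Nat.ListAction using (sum)
open import Data.Maybe using (Maybe; just; nothing)
open import Relation.Binary.PropositionalEquality using (_≡_)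

-- Permutations of {1,…,n}, represented as lists σ₁ ⋯ σₙ (one-line notation).

insertions : ℕ → List ℕ → List (List ℕ)
insertions x []       = (x ∷ []) ∷ []
insertions x (y ∷ ys) = (x ∷ y ∷ ys) ∷ map (y ∷_) (insertions x ys)

S : ℕ → List (List ℕ)
S zero    = [] ∷ []
S (suc n) = concatMap (insertions (suc n)) (S n)

-- 0-based lookup of entries: at σ i = σ_{i+1}
at : List ℕ → ℕ → Maybe ℕ
at []       _       = nothing
at (x ∷ xs) zero    = just x
at (x ∷ xs) (suc i) = at xs i

pattern132At : List ℕ → ℕ → ℕ → ℕ → Bool
pattern132At σ i j k with at σ i | at σ j | at σ k
... | just a | just b | just c = (i <ᵇ j) ∧ (j <ᵇ k) ∧ (a <ᵇ c) ∧ (c <ᵇ b)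
... | _      | _      | _      = false

contains132 : List ℕ → Bool
contains132 σ =
  any (λ i → any (λ j → any (λ k → pattern132At σ i j k) (upTo (length σ)))
                 (upTo (length σ)))
      (upTo (length σ))

avoids132 : List ℕ → Bool
avoids132 σ = not (contains132 σ)

S132 : ℕ → List (List ℕ)
S132 n = filter (λ σ → avoids132 σ Data.Bool.≟ true) (S n)
  where import Data.Bool

adjacent1 : Maybe ℕ → Maybe ℕ → Bool
adjacent1 (just a) (just b) = ∣ a - b ∣ ≡ᵇ 1
adjacent1 _        _        = false

boxAt : List ℕ → ℕ → Bool
boxAt σ zero    = adjacent1 (at σ 0) (at σ 1)
boxAt σ (suc i) = adjacent1 (at σ (suc i)) (at σ (suc (suc i)))
                ∨ adjacent1 (at σ i) (at σ (suc i))

box : List ℕ → ℕ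
box σ = length (filter (λ i → boxAt σ i Data.Bool.≟ true) (upTo (length σ)))
  where import Data.Bool

-- Polynomials in x with ℕ coefficients, as coefficient lists
-- (the k-th entry is the coefficient of x^k).

Poly : Set
Poly = List ℕ

_⊕_ : Poly → Poly → Poly
[]       ⊕ q        = q
(a ∷ p)  ⊕ []       = a ∷ p
(a ∷ p)  ⊕ (b ∷ q)  = (a + b) ∷ (p ⊕ q)

xPow : ℕ → Poly
xPow m = replicate m 0 ++ (1 ∷ [])

coeff : Poly → ℕ → ℕ
coeff []       _       = 0
coeff (a ∷ p)  zero    = a
coeff (a ∷ p)  (suc m) = coeff p m

boxPoly : List (List ℕ) → Poly
boxPoly L = foldr (λ σ acc → xPow (box σ) ⊕ acc) [] L

firstIs : ℕ → List ℕ → Bool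
firstIs n σ with head σ
... | just a  = a ≡ᵇ n
... | nothing = false

lastIs : ℕ → List ℕ → Bool
lastIs n σ with last σ
... | just a  = a ≡ᵇ n
... | nothing = false

-- A_n(x) = Σ_{σ ∈ S_n(132)} x^{box σ}   (A_0 = 1 since S_0 = {ε}, box ε = 0)
A : ℕ → Poly
A n = boxPoly (S132 n)

B : ℕ → Poly
B n = boxPoly (filter (λ σ → firstIs n σ Data.Bool.≟ true) (S132 n))
  where import Data.Bool

E : ℕ → Poly
E n = boxPoly (filter (λ σ → lastIs n σ Data.Bool.≟ true) (S132 n))
  where import Data.Bool

-- Fibonacci with F_0 = F_1 = 1

F : ℕ → ℕ
F zero          = 1
F (suc zero)    = 1
F (suc (suc n)) = F (suc n) + F n

-- Σ_{i=a}^{b} f i   (empty, i.e. 0, when b < a)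
sumFromTo : ℕ → ℕ → (ℕ → ℕ) → ℕ
sumFromTo a b f = sum (map (λ k → f (a + k)) (upTo (suc b ∸ a)))

-- Every σ ∈ S_{n+1}(132) factors uniquely as σ = α (n+1) β, where α and β avoid 132 and every entry
-- of α exceeds every entry of β; this follows by inserting n+1 into each τ ∈ S_n(132), which avoids
-- 132 exactly when the part of τ before n+1 dominates the part after it. If α and β are both
-- nonempty, n+1 is adjacent to neither neighbour and box σ = box (α′ (k+1)) + box β, where α′ ∈
-- S_k(132) is α shifted down; so the coefficients of A_n obey a convolution recurrence. Decomposing
-- B_{n+1} (σ = (n+1) β) and E_{n+1} (σ = α (n+1)) once more links them to A_n and to the permutations
-- starting with (n+2) (n+1), resp. ending with (n+1) (n+2), whose box grows by one or two under the
-- decomposition. The resulting recurrences show E_n = B_n, that box never takes the values 0 or 1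
-- once n ≥ 2, and that the coefficients of x^2 are Fibonacci numbers. Feeding these into the
-- recurrences at x^4 gives the formulas for A_n and B_n.

module Submission where

open import Defs
open import Data.Nat
open import Data.Nat.Properties
open import Data.Nat.Induction using (<-rec)
open import Data.Bool using (Bool; true; false; _∧_; _∨_; not; if_then_else_)
open import Data.Bool.Properties using (∨-comm; ∨-assoc; ∨-identityʳ; ∧-comm; ∧-identityʳ; ∧-zeroʳ)
open import Data.Bool.ListAction using (any; or)
open import Data.List using (List; []; _∷_; _++_; map; concatMap; filter; length; upTo; last)
open import Data.List.Properties using (map-applyUpTo; map-++; ++-assoc)
open import Data.Nat.ListAction using (sum)
open import Data.Maybe using (Maybe; just; nothing)
open import Data.Product using (_×_; _,_; proj₁; proj₂)
open import Data.List.Relation.Unary.All using (All; []; _∷_)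
import Data.List.Relation.Unary.All as All
import Data.List.Relation.Unary.All.Properties as All
open import Function using (_∘_; id)
open import Relation.Binary.PropositionalEquality
open import Algebra.Properties.CommutativeSemigroup +-commutativeSemigroup using (interchange)
open import Data.Nat.Solver using (module +-*-Solver)
open +-*-Solver using (solve; _:+_; _:*_; _:=_; con)
import Data.Bool as Bool

-- Finite sums and convolutions

private variable
  X Y : Set

∑ : (X → ℕ) → List X → ℕ
∑ f []       = 0
∑ f (x ∷ xs) = f x + ∑ f xs

syntax ∑ (λ x → e) xs = ∑[ x ∈ xs ] e

∑-cong : ∀ {f g : X → ℕ} xs → (∀ x → f x ≡ g x) → ∑ f xs ≡ ∑ g xs
∑-cong []       f≗g = refl
∑-cong (x ∷ xs) f≗g = cong₂ _+_ (f≗g x) (∑-cong xs f≗g)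

∑-cong-All : ∀ {f g : X → ℕ} {xs} → All (λ x → f x ≡ g x) xs → ∑ f xs ≡ ∑ g xs
∑-cong-All []           = refl
∑-cong-All (fx≡gx ∷ ps) = cong₂ _+_ fx≡gx (∑-cong-All ps)

∑-zero : (xs : List X) → ∑[ x ∈ xs ] 0 ≡ 0
∑-zero []       = refl
∑-zero (x ∷ xs) = ∑-zero xs

∑-+ : ∀ (f g : X → ℕ) xs → ∑[ x ∈ xs ] (f x + g x) ≡ ∑ f xs + ∑ g xs
∑-+ f g []       = refl
∑-+ f g (x ∷ xs) = trans (cong (f x + g x +_) (∑-+ f g xs)) (interchange (f x) (g x) _ _)

∑-*ˡ : ∀ c (f : X → ℕ) xs → ∑[ x ∈ xs ] (c * f x) ≡ c * ∑ f xs
∑-*ˡ c f []       = sym (*-zeroʳ c)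
∑-*ˡ c f (x ∷ xs) = trans (cong (c * f x +_) (∑-*ˡ c f xs)) (sym (*-distribˡ-+ c (f x) _))

∑-*ʳ : ∀ c (f : X → ℕ) xs → ∑[ x ∈ xs ] (f x * c) ≡ ∑ f xs * c
∑-*ʳ c f []       = refl
∑-*ʳ c f (x ∷ xs) = trans (cong (f x * c +_) (∑-*ʳ c f xs)) (sym (*-distribʳ-+ c (f x) _))

∑-++ : ∀ (f : X → ℕ) xs ys → ∑ f (xs ++ ys) ≡ ∑ f xs + ∑ f ys
∑-++ f []       ys = refl
∑-++ f (x ∷ xs) ys = trans (cong (f x +_) (∑-++ f xs ys)) (sym (+-assoc (f x) _ _))

∑-map : ∀ (f : Y → ℕ) (g : X → Y) xs → ∑ f (map g xs) ≡ ∑ (f ∘ g) xs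
∑-map f g []       = refl
∑-map f g (x ∷ xs) = cong (f (g x) +_) (∑-map f g xs)

∑-concatMap : ∀ (f : Y → ℕ) (g : X → List Y) xs →
              ∑ f (concatMap g xs) ≡ ∑[ x ∈ xs ] ∑ f (g x)
∑-concatMap f g []       = refl
∑-concatMap f g (x ∷ xs) =
  trans (∑-++ f (g x) (concatMap g xs)) (cong (∑ f (g x) +_) (∑-concatMap f g xs))

∑-filter : ∀ (f : X → ℕ) (p : X → Bool) xs →
           ∑ f (filter (λ x → p x Bool.≟ true) xs) ≡ ∑[ x ∈ xs ] (if p x then f x else 0)
∑-filter f p []       = refl
∑-filter f p (x ∷ xs) with p x
... | true  = cong (f x +_) (∑-filter f p xs)
... | false = ∑-filter f p xs

conv : ℕ → (ℕ → ℕ → ℕ) → ℕ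
conv zero    g = g 0 0
conv (suc n) g = g 0 (suc n) + conv n (λ k l → g (suc k) l)

conv-cong : ∀ n {f g : ℕ → ℕ → ℕ} → (∀ k l → k + l ≡ n → f k l ≡ g k l) → conv n f ≡ conv n g
conv-cong zero    f≗g = f≗g 0 0 refl
conv-cong (suc n) f≗g =
  cong₂ _+_ (f≗g 0 (suc n) refl) (conv-cong n (λ k l k+l≡n → f≗g (suc k) l (cong suc k+l≡n)))

conv-zero : ∀ n → conv n (λ _ _ → 0) ≡ 0
conv-zero zero    = refl
conv-zero (suc n) = conv-zero n

conv-+ : ∀ n (f g : ℕ → ℕ → ℕ) → conv n (λ k l → f k l + g k l) ≡ conv n f + conv n g
conv-+ zero    f g = refl
conv-+ (suc n) f g =
  trans (cong (f 0 (suc n) + g 0 (suc n) +_) (conv-+ n (f ∘ suc) (g ∘ suc)))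
        (interchange (f 0 (suc n)) (g 0 (suc n)) _ _)

∑-conv : ∀ n (g : X → ℕ → ℕ → ℕ) xs →
         ∑[ x ∈ xs ] conv n (g x) ≡ conv n (λ k l → ∑[ x ∈ xs ] g x k l)
∑-conv n g []       = sym (conv-zero n)
∑-conv n g (x ∷ xs) = trans (cong (conv n (g x) +_) (∑-conv n g xs)) (sym (conv-+ n (g x) _))

conv-assoc : ∀ n (G : ℕ → ℕ → ℕ → ℕ) →
             conv n (λ k l → conv l (λ i l′ → G k i l′)) ≡ conv n (λ j l′ → conv j (λ k i → G k i l′))
conv-assoc zero    G = refl
conv-assoc (suc n) G = begin
  (G 0 0 (suc n) + rest) + conv n (λ k l → conv l (G (suc k)))
    ≡⟨ cong ((G 0 0 (suc n) + rest) +_) (conv-assoc n (G ∘ suc)) ⟩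
  (G 0 0 (suc n) + rest) + conv n (λ j l′ → conv j (λ k i → G (suc k) i l′))
    ≡⟨ +-assoc (G 0 0 (suc n)) rest _ ⟩
  G 0 0 (suc n) + (rest + conv n (λ j l′ → conv j (λ k i → G (suc k) i l′)))
    ≡⟨ cong (G 0 0 (suc n) +_) (sym (conv-+ n (λ j l′ → G 0 (suc j) l′) _)) ⟩
  G 0 0 (suc n) + conv n (λ j l′ → conv (suc j) (λ k i → G k i l′)) ∎
  where
  open ≡-Reasoning
  rest : ℕ
  rest = conv n (λ i l′ → G 0 (suc i) l′)

conv-sucʳ : ∀ n (g : ℕ → ℕ → ℕ) → conv (suc n) g ≡ conv n (λ k l → g k (suc l)) + g (suc n) 0
conv-sucʳ zero    g = refl
conv-sucʳ (suc n) g =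
  trans (cong (g 0 (suc (suc n)) +_) (conv-sucʳ n (g ∘ suc))) (sym (+-assoc (g 0 (suc (suc n))) _ _))

convTail convInit : ℕ → (ℕ → ℕ → ℕ) → ℕ
convTail zero    g = 0
convTail (suc n) g = conv n (g ∘ suc)
convInit zero    g = 0
convInit (suc n) g = conv n (λ k l → g k (suc l))

conv-split-first : ∀ n g → conv n g ≡ g 0 n + convTail n g
conv-split-first zero    g = sym (+-identityʳ _)
conv-split-first (suc n) g = refl

conv-split-last : ∀ n g → conv n g ≡ convInit n g + g n 0
conv-split-last zero    g = refl
conv-split-last (suc n) g = conv-sucʳ n g

convTail-cong : ∀ n {f g : ℕ → ℕ → ℕ} →
                (∀ k l → suc k + l ≡ n → f (suc k) l ≡ g (suc k) l) → convTail n f ≡ convTail n g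
convTail-cong zero    f≗g = refl
convTail-cong (suc n) f≗g = conv-cong n (λ k l k+l≡n → f≗g k l (cong suc k+l≡n))

convInit-cong : ∀ n {f g : ℕ → ℕ → ℕ} →
                (∀ k l → k + suc l ≡ n → f k (suc l) ≡ g k (suc l)) → convInit n f ≡ convInit n g
convInit-cong zero    f≗g = refl
convInit-cong (suc n) f≗g = conv-cong n (λ k l k+l≡n → f≗g k l (trans (+-suc k l) (cong suc k+l≡n)))

convTail-zero : ∀ n → convTail n (λ _ _ → 0) ≡ 0
convTail-zero zero    = refl
convTail-zero (suc n) = conv-zero n

convInit-zero : ∀ n → convInit n (λ _ _ → 0) ≡ 0
convInit-zero zero    = refl
convInit-zero (suc n) = conv-zero n

<ᵇ≡true : ∀ {m n} → m < n → (m <ᵇ n) ≡ true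
<ᵇ≡true {zero}  {suc n} m<n       = refl
<ᵇ≡true {suc m} {suc n} (s≤s m<n) = <ᵇ≡true m<n

<ᵇ≡false : ∀ {m n} → n ≤ m → (m <ᵇ n) ≡ false
<ᵇ≡false {m}     {zero}  n≤m       = refl
<ᵇ≡false {suc m} {suc n} (s≤s n≤m) = <ᵇ≡false n≤m

<ᵇ-asym : ∀ m n → (m <ᵇ n) ≡ true → (n <ᵇ m) ≡ false
<ᵇ-asym zero    (suc n) _ = refl
<ᵇ-asym (suc m) (suc n) e = <ᵇ-asym m n e

any-cong : ∀ {f g : X → Bool} xs → (∀ x → f x ≡ g x) → any f xs ≡ any g xs
any-cong []       f≗g = refl
any-cong (x ∷ xs) f≗g = cong₂ _∨_ (f≗g x) (any-cong xs f≗g)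

any-false : (xs : List X) → any (λ _ → false) xs ≡ false
any-false []       = refl
any-false (x ∷ xs) = any-false xs

any-upTo-suc : ∀ (f : ℕ → Bool) n → any f (upTo (suc n)) ≡ f 0 ∨ any (f ∘ suc) (upTo n)
any-upTo-suc f n = cong (λ bs → f 0 ∨ or bs)
  (trans (map-applyUpTo suc f n) (sym (map-applyUpTo id (f ∘ suc) n)))

any-at : ∀ (g : Maybe ℕ → Bool) ys → g nothing ≡ false →
         any (λ k → g (at ys k)) (upTo (length ys)) ≡ any (g ∘ just) ys
any-at g []       _ = refl
any-at g (y ∷ ys) e =
  trans (any-upTo-suc (λ k → g (at (y ∷ ys) k)) (length ys)) (cong (g (just y) ∨_) (any-at g ys e))

-- A structural characterisation of 132-containment

between : ℕ → ℕ → ℕ → Bool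
between a b c = (a <ᵇ c) ∧ (c <ᵇ b)

someBetween : ℕ → ℕ → List ℕ → Bool
someBetween a b = any (between a b)

-- starts132 a ys: the list a ∷ ys contains a 132 pattern whose 1 is the entry a.
starts132 : ℕ → List ℕ → Bool
starts132 a []       = false
starts132 a (b ∷ ys) = someBetween a b ys ∨ starts132 a ys

has132 : List ℕ → Bool
has132 []       = false
has132 (x ∷ xs) = starts132 x xs ∨ has132 xs

module _ where
  private
    pattern132At-i≮j : ∀ σ i j k → (i <ᵇ j) ≡ false → pattern132At σ i j k ≡ false
    pattern132At-i≮j σ i j k e with at σ i | at σ j | at σ k
    ... | just _  | just _  | just _  rewrite e = refl
    ... | just _  | just _  | nothing = refl
    ... | just _  | nothing | _       = refl
    ... | nothing | _       | _       = refl

    pattern132At-j≮k : ∀ σ i j k → (j <ᵇ k) ≡ false → pattern132At σ i j k ≡ false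
    pattern132At-j≮k σ i j k e with at σ i | at σ j | at σ k
    ... | just _  | just _  | just _  rewrite e = ∧-zeroʳ (i <ᵇ j)
    ... | just _  | just _  | nothing = refl
    ... | just _  | nothing | _       = refl
    ... | nothing | _       | _       = refl

    pattern132At-suc : ∀ x xs i j k →
                       pattern132At (x ∷ xs) (suc i) (suc j) (suc k) ≡ pattern132At xs i j k
    pattern132At-suc x xs i j k with at xs i | at xs j | at xs k
    ... | just _  | just _  | just _  = refl
    ... | just _  | just _  | nothing = refl
    ... | just _  | nothing | _       = refl
    ... | nothing | _       | _       = refl

    pattern132At-drop : ∀ x b ys j k → pattern132At (x ∷ b ∷ ys) 0 (2 + j) (2 + k) ≡ pattern132At (x ∷ ys) 0 (1 + j) (1 + k)
    pattern132At-drop x b ys j k with at ys j | at ys k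
    ... | just _  | just _  = refl
    ... | just _  | nothing = refl
    ... | nothing | _       = refl

    betweenAt : ℕ → ℕ → Maybe ℕ → Bool
    betweenAt a b (just c) = between a b c
    betweenAt a b nothing  = false

    pattern132At-01 : ∀ x b ys k → pattern132At (x ∷ b ∷ ys) 0 1 (2 + k) ≡ betweenAt x b (at ys k)
    pattern132At-01 x b ys k with at ys k
    ... | just _  = refl
    ... | nothing = refl

    starts132At : ℕ → List ℕ → Bool
    starts132At x xs =
      any (λ j → any (λ k → pattern132At (x ∷ xs) 0 (suc j) (suc k)) (upTo (length xs))) (upTo (length xs))

    starts132At-∷ : ∀ x b ys → starts132At x (b ∷ ys) ≡ someBetween x b ys ∨ starts132At x ys
    starts132At-∷ x b ys = begin
      starts132At x (b ∷ ys)                           ≡⟨ any-upTo-suc row n ⟩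
      row 0 ∨ any (row ∘ suc) (upTo n)                 ≡⟨ cong₂ _∨_ row0 (any-cong (upTo n) rowSuc) ⟩
      someBetween x b ys ∨ starts132At x ys            ∎
      where
      open ≡-Reasoning
      n : ℕ
      n = length ys
      row : ℕ → Bool
      row j = any (λ k → pattern132At (x ∷ b ∷ ys) 0 (suc j) (suc k)) (upTo (suc n))
      row0 : row 0 ≡ someBetween x b ys
      row0 = begin
        row 0
          ≡⟨ any-upTo-suc (λ k → pattern132At (x ∷ b ∷ ys) 0 1 (suc k)) n ⟩
        pattern132At (x ∷ b ∷ ys) 0 1 1 ∨ any (λ k → pattern132At (x ∷ b ∷ ys) 0 1 (2 + k)) (upTo n)
          ≡⟨ cong₂ _∨_ (pattern132At-j≮k (x ∷ b ∷ ys) 0 1 1 refl) (any-cong (upTo n) (pattern132At-01 x b ys)) ⟩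
        any (λ k → betweenAt x b (at ys k)) (upTo n)
          ≡⟨ any-at (betweenAt x b) ys refl ⟩
        someBetween x b ys ∎
      rowSuc : ∀ j → row (suc j) ≡ any (λ k → pattern132At (x ∷ ys) 0 (suc j) (suc k)) (upTo n)
      rowSuc j = begin
        row (suc j)
          ≡⟨ any-upTo-suc (λ k → pattern132At (x ∷ b ∷ ys) 0 (2 + j) (suc k)) n ⟩
        pattern132At (x ∷ b ∷ ys) 0 (2 + j) 1 ∨ any (λ k → pattern132At (x ∷ b ∷ ys) 0 (2 + j) (2 + k)) (upTo n)
          ≡⟨ cong₂ _∨_ (pattern132At-j≮k (x ∷ b ∷ ys) 0 (2 + j) 1 refl) (any-cong (upTo n) (pattern132At-drop x b ys j)) ⟩
        any (λ k → pattern132At (x ∷ ys) 0 (suc j) (suc k)) (upTo n) ∎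

    starts132At≡starts132 : ∀ x xs → starts132At x xs ≡ starts132 x xs
    starts132At≡starts132 x []       = refl
    starts132At≡starts132 x (b ∷ ys) =
      trans (starts132At-∷ x b ys) (cong (someBetween x b ys ∨_) (starts132At≡starts132 x ys))

    contains132-∷ : ∀ x xs → contains132 (x ∷ xs) ≡ starts132 x xs ∨ contains132 xs
    contains132-∷ x xs = begin
      contains132 (x ∷ xs)                       ≡⟨ any-upTo-suc plane n ⟩
      plane 0 ∨ any (plane ∘ suc) (upTo n)       ≡⟨ cong₂ _∨_ plane0 (any-cong (upTo n) planeSuc) ⟩
      starts132 x xs ∨ contains132 xs            ∎
      where
      open ≡-Reasoning
      n : ℕ
      n = length xs
      σ : List ℕ
      σ = x ∷ xs
      -- a pattern needs i < j < k, so j = 0 and k = 0 never contribute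
      noJ0 : ∀ i → any (λ k → pattern132At σ i 0 k) (upTo (suc n)) ≡ false
      noJ0 i = trans (any-cong (upTo (suc n)) (λ k → pattern132At-i≮j σ i 0 k refl)) (any-false (upTo (suc n)))
      dropK0 : ∀ i j → any (λ k → pattern132At σ i (suc j) k) (upTo (suc n))
                     ≡ any (λ k → pattern132At σ i (suc j) (suc k)) (upTo n)
      dropK0 i j = trans (any-upTo-suc (λ k → pattern132At σ i (suc j) k) n)
                         (cong (_∨ any (λ k → pattern132At σ i (suc j) (suc k)) (upTo n)) (pattern132At-j≮k σ i (suc j) 0 refl))
      plane : ℕ → Bool
      plane i = any (λ j → any (λ k → pattern132At σ i j k) (upTo (suc n))) (upTo (suc n))
      plane0 : plane 0 ≡ starts132 x xs
      plane0 = begin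
        plane 0
          ≡⟨ any-upTo-suc (λ j → any (λ k → pattern132At σ 0 j k) (upTo (suc n))) n ⟩
        any (λ k → pattern132At σ 0 0 k) (upTo (suc n)) ∨ any (λ j → any (λ k → pattern132At σ 0 (suc j) k) (upTo (suc n))) (upTo n)
          ≡⟨ cong₂ _∨_ (noJ0 0) (any-cong (upTo n) (dropK0 0)) ⟩
        starts132At x xs
          ≡⟨ starts132At≡starts132 x xs ⟩
        starts132 x xs ∎
      planeSuc : ∀ i → plane (suc i) ≡ any (λ j → any (λ k → pattern132At xs i j k) (upTo n)) (upTo n)
      planeSuc i = begin
        plane (suc i)
          ≡⟨ any-upTo-suc (λ j → any (λ k → pattern132At σ (suc i) j k) (upTo (suc n))) n ⟩
        any (λ k → pattern132At σ (suc i) 0 k) (upTo (suc n)) ∨ any (λ j → any (λ k → pattern132At σ (suc i) (suc j) k) (upTo (suc n))) (upTo n)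
          ≡⟨ cong₂ _∨_ (noJ0 (suc i)) (any-cong (upTo n) (λ j → trans (dropK0 (suc i) j) (any-cong (upTo n) (pattern132At-suc x xs i j)))) ⟩
        any (λ j → any (λ k → pattern132At xs i j k) (upTo n)) (upTo n) ∎

  contains132≡has132 : ∀ σ → contains132 σ ≡ has132 σ
  contains132≡has132 []       = refl
  contains132≡has132 (x ∷ xs) = trans (contains132-∷ x xs) (cong (starts132 x xs ∨_) (contains132≡has132 xs))

Below : ℕ → ℕ → Set
Below m c = (c <ᵇ m) ≡ true

atMost : List ℕ → ℕ → Bool
atMost []       a = true
atMost (c ∷ cs) a = not (a <ᵇ c) ∧ atMost cs a

dominates : List ℕ → List ℕ → Bool
dominates []      v = true
dominates (a ∷ u) v = atMost v a ∧ dominates u v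

module _ where
  private
    not-∧ : ∀ x y → not (x ∧ y) ≡ not x ∨ not y
    not-∧ true  y = refl
    not-∧ false y = refl

    ∨-interchange : ∀ p q r s → (p ∨ q) ∨ (r ∨ s) ≡ (p ∨ r) ∨ (q ∨ s)
    ∨-interchange true  q     r     s = refl
    ∨-interchange false true  true  s = refl
    ∨-interchange false true  false s = refl
    ∨-interchange false false r     s = refl

    someBetween-skip : ∀ a b m v → (m <ᵇ b) ≡ false →
                       ∀ w → someBetween a b (w ++ m ∷ v) ≡ someBetween a b (w ++ v)
    someBetween-skip a b m v m≮b []      rewrite m≮b | ∧-zeroʳ (a <ᵇ m) = refl
    someBetween-skip a b m v m≮b (c ∷ w) = cong (between a b c ∨_) (someBetween-skip a b m v m≮b w)

    someBetween-max : ∀ a m v → All (Below m) v → someBetween a m v ≡ not (atMost v a)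
    someBetween-max a m []      []       = refl
    someBetween-max a m (c ∷ v) (c<m ∷ v<m) rewrite c<m | ∧-identityʳ (a <ᵇ c) =
      trans (cong ((a <ᵇ c) ∨_) (someBetween-max a m v v<m)) (not-¬∧ (a <ᵇ c) (atMost v a))
      where
      not-¬∧ : ∀ x y → x ∨ not y ≡ not (not x ∧ y)
      not-¬∧ true  y = refl
      not-¬∧ false y = refl

    someBetween-from-max : ∀ m b v → All (Below m) v → someBetween m b v ≡ false
    someBetween-from-max m b []      []          = refl
    someBetween-from-max m b (c ∷ v) (c<m ∷ v<m) rewrite <ᵇ-asym c m c<m = someBetween-from-max m b v v<m

    starts132-max : ∀ m v → All (Below m) v → starts132 m v ≡ false
    starts132-max m []      []          = refl
    starts132-max m (b ∷ v) (b<m ∷ v<m) rewrite someBetween-from-max m b v v<m = starts132-max m v v<m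

    starts132-insert : ∀ a m v → All (Below m) v → ∀ u → All (Below m) u →
                       starts132 a (u ++ m ∷ v) ≡ starts132 a (u ++ v) ∨ not (atMost v a)
    starts132-insert a m v v<m []      []          rewrite someBetween-max a m v v<m =
      ∨-comm (not (atMost v a)) (starts132 a v)
    starts132-insert a m v v<m (b ∷ u) (b<m ∷ u<m) =
      trans (cong₂ _∨_ (someBetween-skip a b m v (<ᵇ-asym b m b<m) u) (starts132-insert a m v v<m u u<m))
            (sym (∨-assoc (someBetween a b (u ++ v)) (starts132 a (u ++ v)) _))

  has132-insert : ∀ m v → All (Below m) v → ∀ u → All (Below m) u →
                  has132 (u ++ m ∷ v) ≡ has132 (u ++ v) ∨ not (dominates u v)
  has132-insert m v v<m []      []          rewrite starts132-max m v v<m = sym (∨-identityʳ (has132 v))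
  has132-insert m v v<m (a ∷ u) (a<m ∷ u<m) = begin
    starts132 a (u ++ m ∷ v) ∨ has132 (u ++ m ∷ v)
      ≡⟨ cong₂ _∨_ (starts132-insert a m v v<m u u<m) (has132-insert m v v<m u u<m) ⟩
    (starts132 a (u ++ v) ∨ not (atMost v a)) ∨ (has132 (u ++ v) ∨ not (dominates u v))
      ≡⟨ ∨-interchange (starts132 a (u ++ v)) _ (has132 (u ++ v)) _ ⟩
    has132 (a ∷ u ++ v) ∨ (not (atMost v a) ∨ not (dominates u v))
      ≡⟨ cong (has132 (a ∷ u ++ v) ∨_) (sym (not-∧ (atMost v a) (dominates u v))) ⟩
    has132 (a ∷ u ++ v) ∨ not (dominates (a ∷ u) v) ∎
    where open ≡-Reasoning

avoids132-insert : ∀ m u v → All (Below m) (u ++ v) →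
                   avoids132 (u ++ m ∷ v) ≡ avoids132 (u ++ v) ∧ dominates u v
avoids132-insert m u v uv<m = begin
  not (contains132 (u ++ m ∷ v))
    ≡⟨ cong not (contains132≡has132 (u ++ m ∷ v)) ⟩
  not (has132 (u ++ m ∷ v))
    ≡⟨ cong not (has132-insert m v (All.++⁻ʳ u uv<m) u (All.++⁻ˡ u uv<m)) ⟩
  not (has132 (u ++ v) ∨ not (dominates u v))
    ≡⟨ not-∨-not (has132 (u ++ v)) (dominates u v) ⟩
  not (has132 (u ++ v)) ∧ dominates u v
    ≡⟨ cong (λ b → not b ∧ dominates u v) (sym (contains132≡has132 (u ++ v))) ⟩
  avoids132 (u ++ v) ∧ dominates u v ∎
  where
  open ≡-Reasoning
  not-∨-not : ∀ x y → not (x ∨ not y) ≡ not x ∧ y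
  not-∨-not true  y     = refl
  not-∨-not false true  = refl
  not-∨-not false false = refl

∑splits : (List ℕ → List ℕ → ℕ) → List ℕ → ℕ
∑splits H []       = H [] []
∑splits H (y ∷ ys) = H [] (y ∷ ys) + ∑splits (λ u v → H (y ∷ u) v) ys

∑cuts : (List ℕ → List ℕ → ℕ) → List ℕ → ℕ
∑cuts H = ∑splits (λ u v → if dominates u v then H u v else 0)

∑splits-cong : ∀ τ {H H′ : List ℕ → List ℕ → ℕ} →
               (∀ u v → u ++ v ≡ τ → H u v ≡ H′ u v) → ∑splits H τ ≡ ∑splits H′ τ
∑splits-cong []       H≗H′ = H≗H′ [] [] refl
∑splits-cong (y ∷ ys) H≗H′ =
  cong₂ _+_ (H≗H′ [] (y ∷ ys) refl) (∑splits-cong ys (λ u v uv≡ys → H≗H′ (y ∷ u) v (cong (y ∷_) uv≡ys)))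

∑splits-zero : ∀ τ → ∑splits (λ _ _ → 0) τ ≡ 0
∑splits-zero []       = refl
∑splits-zero (y ∷ ys) = ∑splits-zero ys

∑-insertions : ∀ (g : List ℕ → ℕ) m τ → ∑ g (insertions m τ) ≡ ∑splits (λ u v → g (u ++ m ∷ v)) τ
∑-insertions g m []       = +-identityʳ _
∑-insertions g m (y ∷ ys) =
  cong (g (m ∷ y ∷ ys) +_) (trans (∑-map g (y ∷_) (insertions m ys)) (∑-insertions (g ∘ (y ∷_)) m ys))

if-∧ : ∀ a b {x : ℕ} → (if a ∧ b then x else 0) ≡ (if a then (if b then x else 0) else 0)
if-∧ true  b = refl
if-∧ false b = refl

∑splits-avoiding : ∀ m τ → All (Below m) τ → (H : List ℕ → List ℕ → ℕ) →
                   ∑splits (λ u v → if avoids132 (u ++ m ∷ v) then H u v else 0) τ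
                   ≡ (if avoids132 τ then ∑cuts H τ else 0)
∑splits-avoiding m τ τ<m H =
  trans (∑splits-cong τ (λ u v uv≡τ → trans (cong (λ b → if b then H u v else 0) (split u v uv≡τ))
                                             (if-∧ (avoids132 τ) (dominates u v))))
        (case (avoids132 τ))
  where
  split : ∀ u v → u ++ v ≡ τ → avoids132 (u ++ m ∷ v) ≡ avoids132 τ ∧ dominates u v
  split u v refl = avoids132-insert m u v τ<m
  case : ∀ a → ∑splits (λ u v → if a then (if dominates u v then H u v else 0) else 0) τ
               ≡ (if a then ∑cuts H τ else 0)
  case true  = refl
  case false = ∑splits-zero τ

insertions-All : ∀ {P : ℕ → Set} m τ → P m → All P τ → All (All P) (insertions m τ)
insertions-All m []       pm []         = (pm ∷ []) ∷ []
insertions-All m (y ∷ ys) pm (py ∷ pys) =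
  (pm ∷ py ∷ pys) ∷ All.map⁺ (All.map (py ∷_) (insertions-All m ys pm pys))

insertions-length : ∀ m τ → All (λ σ → length σ ≡ suc (length τ)) (insertions m τ)
insertions-length m []       = refl ∷ []
insertions-length m (y ∷ ys) = refl ∷ All.map⁺ (All.map (cong suc) (insertions-length m ys))

S-bounded : ∀ n → All (All (_≤ n)) (S n)
S-bounded zero    = [] ∷ []
S-bounded (suc n) = All.concat⁺ (All.map⁺ (All.map
  (λ {τ} τ≤n → insertions-All (suc n) τ ≤-refl (All.map m≤n⇒m≤1+n τ≤n)) (S-bounded n)))

S-length : ∀ n → All (λ σ → length σ ≡ n) (S n)
S-length zero    = refl ∷ []
S-length (suc n) = All.concat⁺ (All.map⁺ (All.map
  (λ {τ} |τ|≡n → All.map (λ |σ|≡ → trans |σ|≡ (cong suc |τ|≡n)) (insertions-length (suc n) τ)) (S-length n)))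

S132-bounded : ∀ n → All (All (_≤ n)) (S132 n)
S132-bounded n = All.filter⁺ (λ σ → avoids132 σ Bool.≟ true) (S-bounded n)

S132-length : ∀ n → All (λ σ → length σ ≡ n) (S132 n)
S132-length n = All.filter⁺ (λ σ → avoids132 σ Bool.≟ true) (S-length n)

∑-S132-suc : ∀ n (f : List ℕ → ℕ) →
             ∑ f (S132 (suc n)) ≡ ∑[ τ ∈ S132 n ] ∑cuts (λ u v → f (u ++ suc n ∷ v)) τ
∑-S132-suc n f = begin
  ∑ f (S132 (suc n))
    ≡⟨ ∑-filter f avoids132 (concatMap (insertions (suc n)) (S n)) ⟩
  ∑ f′ (concatMap (insertions (suc n)) (S n))
    ≡⟨ ∑-concatMap f′ (insertions (suc n)) (S n) ⟩
  ∑[ τ ∈ S n ] ∑ f′ (insertions (suc n) τ)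
    ≡⟨ ∑-cong (S n) (∑-insertions f′ (suc n)) ⟩
  ∑[ τ ∈ S n ] ∑splits (λ u v → f′ (u ++ suc n ∷ v)) τ
    ≡⟨ ∑-cong-All (All.map (λ τ≤n → ∑splits-avoiding (suc n) _ (All.map (<ᵇ≡true ∘ s≤s) τ≤n) H) (S-bounded n)) ⟩
  ∑[ τ ∈ S n ] (if avoids132 τ then ∑cuts H τ else 0)
    ≡⟨ ∑-filter (∑cuts H) avoids132 (S n) ⟨
  ∑ (∑cuts H) (S132 n) ∎
  where
  open ≡-Reasoning
  f′ : List ℕ → ℕ
  f′ σ = if avoids132 σ then f σ else 0
  H : List ℕ → List ℕ → ℕ
  H u v = f (u ++ suc n ∷ v)

-- The decomposition σ = α (n+1) β of 132-avoiding permutations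

module _ where
  private
    ∧-true : ∀ a b → a ∧ b ≡ true → (a ≡ true) × (b ≡ true)
    ∧-true true true refl = refl , refl

    atMost-++ʳ : ∀ u v x → atMost (u ++ v) x ≡ true → atMost v x ≡ true
    atMost-++ʳ []      v x e = e
    atMost-++ʳ (c ∷ u) v x e = atMost-++ʳ u v x (proj₂ (∧-true _ _ e))

    atMost-past : ∀ x m w v → (x <ᵇ m) ≡ true → atMost (w ++ m ∷ v) x ≡ false
    atMost-past x m []      v x<m rewrite x<m = refl
    atMost-past x m (c ∷ w) v x<m rewrite atMost-past x m w v x<m = ∧-zeroʳ _

    atMost-max : ∀ m v → All (Below m) v → atMost v m ≡ true
    atMost-max m []      []          = refl
    atMost-max m (c ∷ v) (c<m ∷ v<m) rewrite <ᵇ-asym c m c<m = atMost-max m v v<m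

  ∑cuts-past-max : ∀ m xs β (h : List ℕ → List ℕ → ℕ) → All (Below m) xs → All (Below m) β →
                   dominates xs β ≡ true →
                   ∑cuts h (xs ++ m ∷ β) ≡ h [] (xs ++ m ∷ β) + ∑cuts (λ u v → h (xs ++ m ∷ u) v) β
  ∑cuts-past-max m [] β h [] β<m _ = cong (h [] (m ∷ β) +_)
    (∑splits-cong β (λ u v uv≡β → cong (λ b → if b ∧ dominates u v then h (m ∷ u) v else 0)
      (atMost-max m v (All.++⁻ʳ u (subst (All (Below m)) (sym uv≡β) β<m)))))
  ∑cuts-past-max m (x ∷ xs) β h (x<m ∷ xs<m) β<m dom = cong (h [] (x ∷ xs ++ m ∷ β) +_) (begin
    ∑splits (λ u v → if atMost v x ∧ dominates u v then h (x ∷ u) v else 0) (xs ++ m ∷ β)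
      ≡⟨ ∑splits-cong (xs ++ m ∷ β) (λ u v _ → trans (cong (λ b → if b then h (x ∷ u) v else 0) (∧-comm (atMost v x) (dominates u v)))
                                                (if-∧ (dominates u v) (atMost v x))) ⟩
    ∑cuts h′ (xs ++ m ∷ β)
      ≡⟨ ∑cuts-past-max m xs β h′ xs<m β<m (proj₂ dom′) ⟩
    h′ [] (xs ++ m ∷ β) + ∑cuts (λ u v → h′ (xs ++ m ∷ u) v) β
      ≡⟨ cong₂ _+_ (cong (λ b → if b then h (x ∷ []) (xs ++ m ∷ β) else 0) (atMost-past x m xs β x<m))
                   (∑splits-cong β (λ u v uv≡β → cong (λ b → if dominates u v then (if b then h (x ∷ xs ++ m ∷ u) v else 0) else 0)
                     (atMost-++ʳ u v x (subst (λ w → atMost w x ≡ true) (sym uv≡β) (proj₁ dom′))))) ⟩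
    ∑cuts (λ u v → h (x ∷ xs ++ m ∷ u) v) β ∎)
    where
    open ≡-Reasoning
    h′ : List ℕ → List ℕ → ℕ
    h′ u v = if atMost v x then h (x ∷ u) v else 0
    dom′ : (atMost β x ≡ true) × (dominates xs β ≡ true)
    dom′ = ∧-true _ _ dom

shift : ℕ → List ℕ → List ℕ
shift l = map (l +_)

shift-shift : ∀ l i α → shift l (shift i α) ≡ shift (i + l) α
shift-shift l i []      = refl
shift-shift l i (a ∷ α) =
  cong₂ _∷_ (trans (sym (+-assoc l i a)) (cong (_+ a) (+-comm l i))) (shift-shift l i α)

shift-zero : ∀ α → shift 0 α ≡ α
shift-zero []      = refl
shift-zero (a ∷ α) = cong (a ∷_) (shift-zero α)

-- α is shifted so that all its entries lie above those of β.
∑stacked : (List ℕ → List ℕ → ℕ) → ℕ → ℕ → ℕ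
∑stacked h k l = ∑[ α ∈ S132 k ] ∑[ β ∈ S132 l ] h (shift l α) β

∑stacked-cong : ∀ {h h′ : List ℕ → List ℕ → ℕ} k l →
                (∀ α β → All (_≤ k) α → length α ≡ k → All (_≤ l) β → length β ≡ l →
                 h (shift l α) β ≡ h′ (shift l α) β) →
                ∑stacked h k l ≡ ∑stacked h′ k l
∑stacked-cong k l h≗h′ = ∑-cong-All (All.zipWith (λ {α} (α≤k , |α|) → ∑-cong-All (All.zipWith
  (λ {β} (β≤l , |β|) → h≗h′ α β α≤k |α| β≤l |β|) (S132-bounded l , S132-length l))) (S132-bounded k , S132-length k))

∑stacked-zero : ∀ k l → ∑stacked (λ _ _ → 0) k l ≡ 0
∑stacked-zero k l = trans (∑-cong (S132 k) (λ _ → ∑-zero (S132 l))) (∑-zero (S132 k))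

∑around : ℕ → (List ℕ → ℕ) → ℕ → ℕ → ℕ
∑around n f = ∑stacked (λ u v → f (u ++ suc n ∷ v))

DecompositionFormula : ℕ → Set
DecompositionFormula n = ∀ (f : List ℕ → ℕ) → ∑ f (S132 (suc n)) ≡ conv n (∑around n f)

-- The dominating cuts of the elements of S_m(132) are exactly the stacked pairs. This and the
-- decomposition are proved together by strong induction.
CutFormula : ℕ → Set
CutFormula m = ∀ (h : List ℕ → List ℕ → ℕ) → ∑ (∑cuts h) (S132 m) ≡ conv m (∑stacked h)

cut⇒decomposition : ∀ n → CutFormula n → DecompositionFormula n
cut⇒decomposition n cuts f = trans (∑-S132-suc n f) (cuts (λ u v → f (u ++ suc n ∷ v)))

module CutFormulaStep (m′ : ℕ) (ih : ∀ j → j ≤ m′ → CutFormula j) where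
  m : ℕ
  m = suc m′

  decomposition : ∀ j → j ≤ m′ → DecompositionFormula j
  decomposition j j≤m′ = cut⇒decomposition j (ih j j≤m′)

  stacked-below-max : ∀ k l → k + l ≡ m′ → ∀ {α β} → All (_≤ k) α → All (_≤ l) β →
                      All (Below m) (shift l α) × All (Below m) β × dominates (shift l α) β ≡ true
  stacked-below-max k l k+l≡m′ {α} {β} α≤k β≤l =
      All.map⁺ (All.map (λ {a} a≤k → <ᵇ≡true (s≤s (subst (l + a ≤_) l+k≡m′ (+-monoʳ-≤ l a≤k)))) α≤k)
    , All.map (λ b≤l → <ᵇ≡true (s≤s (≤-trans b≤l (subst (l ≤_) k+l≡m′ (m≤n+m l k))))) β≤l
    , dominates-above (shift l α) (All.map⁺ (All.map (λ {a} _ → All.map (λ b≤l → ≤-trans b≤l (m≤m+n l a)) β≤l) α≤k))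
    where
    l+k≡m′ : l + k ≡ m′
    l+k≡m′ = trans (+-comm l k) k+l≡m′
    dominates-above : ∀ xs → All (λ a → All (_≤ a) β) xs → dominates xs β ≡ true
    dominates-above []       []         = refl
    dominates-above (a ∷ xs) (β≤a ∷ ps) rewrite dominates-above xs ps = trans (∧-identityʳ _) (atMost-above β β≤a)
      where
      atMost-above : ∀ v → All (_≤ a) v → atMost v a ≡ true
      atMost-above []      []          = refl
      atMost-above (b ∷ v) (b≤a ∷ v≤a) rewrite <ᵇ≡false b≤a = atMost-above v v≤a

  -- the terms of the double convolution reached by both ways of summing
  triple : (List ℕ → List ℕ → ℕ) → ℕ → ℕ → ℕ → ℕ
  triple h k i l′ = ∑[ α ∈ S132 k ] ∑[ γ ∈ S132 i ] ∑[ δ ∈ S132 l′ ] h (shift (i + l′) α ++ m ∷ shift l′ γ) δ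

  split-cuts : ∀ h k l → k + l ≡ m′ →
               ∑stacked (λ u v → ∑cuts h (u ++ m ∷ v)) k l
               ≡ ∑stacked (λ u v → h [] (u ++ m ∷ v)) k l + conv l (triple h k)
  split-cuts h k l k+l≡m′ = begin
    ∑stacked (λ u v → ∑cuts h (u ++ m ∷ v)) k l
      ≡⟨ ∑-cong-All (All.map (λ {α} α≤k → trans
           (∑-cong-All (All.map (λ {β} β≤l → let (α<m , β<m , dom) = stacked-below-max k l k+l≡m′ α≤k β≤l in
                                   ∑cuts-past-max m (shift l α) β h α<m β<m dom) (S132-bounded l)))
           (∑-+ _ _ (S132 l))) (S132-bounded k)) ⟩
    ∑[ α ∈ S132 k ] (∑[ β ∈ S132 l ] h [] (shift l α ++ m ∷ β) + ∑[ β ∈ S132 l ] ∑cuts (λ u v → h (shift l α ++ m ∷ u) v) β)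
      ≡⟨ ∑-+ _ _ (S132 k) ⟩
    ∑stacked (λ u v → h [] (u ++ m ∷ v)) k l + ∑[ α ∈ S132 k ] ∑ (∑cuts (λ u v → h (shift l α ++ m ∷ u) v)) (S132 l)
      ≡⟨ cong (whole +_) (∑-cong (S132 k) (λ α → ih l (subst (l ≤_) k+l≡m′ (m≤n+m l k)) (λ u v → h (shift l α ++ m ∷ u) v))) ⟩
    ∑stacked (λ u v → h [] (u ++ m ∷ v)) k l + ∑[ α ∈ S132 k ] conv l (∑stacked (λ u v → h (shift l α ++ m ∷ u) v))
      ≡⟨ cong (whole +_) (trans (∑-conv l _ (S132 k)) (conv-cong l (λ i l′ i+l′≡l →
           cong (λ s → ∑[ α ∈ S132 k ] ∑[ γ ∈ S132 i ] ∑[ δ ∈ S132 l′ ] h (shift s α ++ m ∷ shift l′ γ) δ) (sym i+l′≡l)))) ⟩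
    ∑stacked (λ u v → h [] (u ++ m ∷ v)) k l + conv l (triple h k) ∎
    where
    open ≡-Reasoning
    whole : ℕ
    whole = ∑stacked (λ u v → h [] (u ++ m ∷ v)) k l

  stacked-suc : ∀ h j l′ → j + l′ ≡ m′ → ∑stacked h (suc j) l′ ≡ conv j (λ k i → triple h k i l′)
  stacked-suc h j l′ j+l′≡m′ =
    trans (decomposition j (subst (j ≤_) j+l′≡m′ (m≤m+n j l′)) (λ γ → ∑[ δ ∈ S132 l′ ] h (shift l′ γ) δ))
      (conv-cong j (λ k i _ → ∑-cong (S132 k) (λ α → ∑-cong (S132 i) (λ γ → ∑-cong (S132 l′) (λ δ →
        cong (λ w → h w δ) (trans (map-++ (l′ +_) (shift i α) (suc j ∷ γ))
                                  (cong₂ _++_ (shift-shift l′ i α) (cong (_∷ shift l′ γ) top))))))))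
    where
    top : l′ + suc j ≡ m
    top = trans (+-suc l′ j) (cong suc (trans (+-comm l′ j) j+l′≡m′))

  cutFormula : CutFormula m
  cutFormula h = begin
    ∑ (∑cuts h) (S132 m)
      ≡⟨ decomposition m′ ≤-refl (∑cuts h) ⟩
    conv m′ (∑stacked (λ u v → ∑cuts h (u ++ m ∷ v)))
      ≡⟨ conv-cong m′ (split-cuts h) ⟩
    conv m′ (λ k l → ∑stacked (λ u v → h [] (u ++ m ∷ v)) k l + conv l (triple h k))
      ≡⟨ conv-+ m′ _ _ ⟩
    conv m′ (∑stacked (λ u v → h [] (u ++ m ∷ v))) + conv m′ (λ k l → conv l (triple h k))
      ≡⟨ cong₂ _+_ (trans (sym (decomposition m′ ≤-refl (h []))) (sym (+-identityʳ _))) (conv-assoc m′ (triple h)) ⟩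
    ∑stacked h 0 m + conv m′ (λ j l′ → conv j (λ k i → triple h k i l′))
      ≡⟨ cong (∑stacked h 0 m +_) (sym (conv-cong m′ (stacked-suc h))) ⟩
    conv m (∑stacked h) ∎
    where open ≡-Reasoning

S132-cuts : ∀ m → CutFormula m
S132-cuts = <-rec CutFormula step
  where
  step : ∀ m → (∀ {j} → j < m → CutFormula j) → CutFormula m
  step zero    _  h = cong (_+ 0) (sym (+-identityʳ (h [] [])))
  step (suc m) ih = CutFormulaStep.cutFormula m (λ j j≤m → ih (s≤s j≤m))

S132-decomposition : ∀ n → DecompositionFormula n
S132-decomposition n = cut⇒decomposition n (S132-cuts n)

-- The box statistic under concatenation and shifting

module _ where
  private
    ∑-upTo-suc : ∀ (g : ℕ → ℕ) n → ∑ g (upTo (suc n)) ≡ g 0 + ∑ (g ∘ suc) (upTo n)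
    ∑-upTo-suc g n = cong (g 0 +_) (trans (cong (∑ g) (sym (map-applyUpTo id suc n))) (∑-map g suc (upTo n)))

    length≡∑1 : (xs : List X) → length xs ≡ ∑[ x ∈ xs ] 1
    length≡∑1 []       = refl
    length≡∑1 (x ∷ xs) = cong suc (length≡∑1 xs)

    box≡∑ : ∀ σ → box σ ≡ ∑[ i ∈ upTo (length σ) ] (if boxAt σ i then 1 else 0)
    box≡∑ σ = trans (length≡∑1 (filter (λ i → boxAt σ i Bool.≟ true) (upTo (length σ))))
                    (∑-filter (λ _ → 1) (boxAt σ) (upTo (length σ)))

  -- the boxed positions gained by putting x in front of xs: x itself and possibly the old first entry
  newBoxes : ℕ → List ℕ → ℕ
  newBoxes x xs = if adjacent1 (just x) (at xs 0) then (if adjacent1 (at xs 0) (at xs 1) then 1 else 2) else 0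

  box-∷ : ∀ x xs → box (x ∷ xs) ≡ box xs + newBoxes x xs
  box-∷ x []       = refl
  box-∷ x (y ∷ ys) = begin
    box (x ∷ y ∷ ys)                                  ≡⟨ box≡∑ (x ∷ y ∷ ys) ⟩
    ∑ g (upTo (2 + n))                                ≡⟨ ∑-upTo-suc g (suc n) ⟩
    g 0 + ∑ (g ∘ suc) (upTo (suc n))                  ≡⟨ cong (g 0 +_) (∑-upTo-suc (g ∘ suc) n) ⟩
    g 0 + (g 1 + ∑ (g ∘ suc ∘ suc) (upTo n))          ≡⟨ count (adjacent1 (just x) (just y)) (adjacent1 (just y) (at ys 0)) _ ⟩
    (g′ 0 + ∑ (g′ ∘ suc) (upTo n)) + newBoxes x (y ∷ ys) ≡⟨ cong (_+ newBoxes x (y ∷ ys)) (sym (trans (box≡∑ (y ∷ ys)) (∑-upTo-suc g′ n))) ⟩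
    box (y ∷ ys) + newBoxes x (y ∷ ys)                ∎
    where
    open ≡-Reasoning
    n : ℕ
    n = length ys
    g g′ : ℕ → ℕ
    g  i = if boxAt (x ∷ y ∷ ys) i then 1 else 0
    g′ i = if boxAt (y ∷ ys) i then 1 else 0
    count : ∀ a b R → (if a then 1 else 0) + ((if b ∨ a then 1 else 0) + R)
                      ≡ ((if b then 1 else 0) + R) + (if a then (if b then 1 else 2) else 0)
    count true  true  R = cong suc (+-comm 1 R)
    count true  false R = +-comm 2 R
    count false true  R = sym (+-identityʳ _)
    count false false R = sym (+-identityʳ _)

adjacent1-far : ∀ a b → suc a < b → adjacent1 (just a) (just b) ≡ false
adjacent1-far zero    (suc (suc b)) _           = refl
adjacent1-far zero    (suc zero)    (s≤s ())
adjacent1-far (suc a) (suc b)       (s≤s 1+a<b) = adjacent1-far a b 1+a<b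

adjacent1-far′ : ∀ a b → suc a < b → adjacent1 (just b) (just a) ≡ false
adjacent1-far′ a b 1+a<b = trans (cong (_≡ᵇ 1) (∣-∣-comm b a)) (adjacent1-far a b 1+a<b)

adjacent1-suc : ∀ a → adjacent1 (just a) (just (suc a)) ≡ true
adjacent1-suc zero    = refl
adjacent1-suc (suc a) = adjacent1-suc a

adjacent1-suc′ : ∀ a → adjacent1 (just (suc a)) (just a) ≡ true
adjacent1-suc′ zero    = refl
adjacent1-suc′ (suc a) = adjacent1-suc′ a

newBoxes-far : ∀ x xs → adjacent1 (just x) (at xs 0) ≡ false → newBoxes x xs ≡ 0
newBoxes-far x []      _ = refl
newBoxes-far x (y ∷ ys) far rewrite far = refl

box-∷-far : ∀ x xs → adjacent1 (just x) (at xs 0) ≡ false → box (x ∷ xs) ≡ box xs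
box-∷-far x xs far = trans (box-∷ x xs) (trans (cong (box xs +_) (newBoxes-far x xs far)) (+-identityʳ _))

box-shift : ∀ l σ → box (shift l σ) ≡ box σ
box-shift l []       = refl
box-shift l (x ∷ xs) =
  trans (box-∷ (l + x) (shift l xs)) (trans (cong₂ _+_ (box-shift l xs) (newBoxes-shift xs)) (sym (box-∷ x xs)))
  where
  adjacent1-shift : ∀ a b → adjacent1 (just (l + a)) (just (l + b)) ≡ adjacent1 (just a) (just b)
  adjacent1-shift a b = cong (_≡ᵇ 1) (∣m+n-m+o∣≡∣n-o∣ l a b)
  newBoxes-shift : ∀ xs → newBoxes (l + x) (shift l xs) ≡ newBoxes x xs
  newBoxes-shift []               = refl
  newBoxes-shift (y ∷ [])         rewrite adjacent1-shift x y = refl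
  newBoxes-shift (y ∷ z ∷ zs)     rewrite adjacent1-shift x y | adjacent1-shift y z = refl

last-++ : ∀ xs y (ys : List X) → last (xs ++ y ∷ ys) ≡ last (y ∷ ys)
last-++ []           y ys = refl
last-++ (x ∷ [])     y ys = refl
last-++ (x ∷ x′ ∷ xs) y ys = last-++ (x′ ∷ xs) y ys

box-++ : ∀ xs ys → adjacent1 (last xs) (at ys 0) ≡ false → box (xs ++ ys) ≡ box xs + box ys
box-++ []               ys far = refl
box-++ (x ∷ [])         ys far = trans (box-∷ x ys) (trans (cong (box ys +_) (newBoxes-far x ys far)) (+-identityʳ (box ys)))
box-++ (x ∷ y ∷ xs)     ys far = begin
  box (x ∷ y ∷ xs ++ ys)                               ≡⟨ box-∷ x (y ∷ xs ++ ys) ⟩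
  box (y ∷ xs ++ ys) + newBoxes x (y ∷ xs ++ ys)       ≡⟨ cong₂ _+_ (box-++ (y ∷ xs) ys far) (same-front xs far) ⟩
  (box (y ∷ xs) + box ys) + newBoxes x (y ∷ xs)        ≡⟨ +-assoc (box (y ∷ xs)) (box ys) _ ⟩
  box (y ∷ xs) + (box ys + newBoxes x (y ∷ xs))        ≡⟨ cong (box (y ∷ xs) +_) (+-comm (box ys) _) ⟩
  box (y ∷ xs) + (newBoxes x (y ∷ xs) + box ys)        ≡⟨ sym (+-assoc (box (y ∷ xs)) _ (box ys)) ⟩
  (box (y ∷ xs) + newBoxes x (y ∷ xs)) + box ys        ≡⟨ cong (_+ box ys) (sym (box-∷ x (y ∷ xs))) ⟩
  box (x ∷ y ∷ xs) + box ys                            ∎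
  where
  open ≡-Reasoning
  -- newBoxes looks at most two entries ahead; with a single entry left, the junction decides
  same-front : ∀ xs → adjacent1 (last (y ∷ xs)) (at ys 0) ≡ false → newBoxes x (y ∷ xs ++ ys) ≡ newBoxes x (y ∷ xs)
  same-front []      far′ rewrite far′ = refl
  same-front (z ∷ _) _    = refl

newBoxesʳ : List ℕ → ℕ → ℕ
newBoxesʳ []               m = 0
newBoxesʳ (x ∷ [])         m = if adjacent1 (just x) (just m) then 2 else 0
newBoxesʳ (x ∷ y ∷ [])     m = if adjacent1 (just y) (just m) then (if adjacent1 (just x) (just y) then 1 else 2) else 0
newBoxesʳ (x ∷ y ∷ z ∷ zs) m = newBoxesʳ (y ∷ z ∷ zs) m

box-∷ʳ : ∀ xs m → box (xs ++ m ∷ []) ≡ box xs + newBoxesʳ xs m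
box-∷ʳ []           m = refl
box-∷ʳ (x ∷ [])     m = box-∷ x (m ∷ [])
box-∷ʳ (x ∷ y ∷ []) m = begin
  box (x ∷ y ∷ m ∷ [])                                      ≡⟨ box-∷ x (y ∷ m ∷ []) ⟩
  box (y ∷ m ∷ []) + newBoxes x (y ∷ m ∷ [])                ≡⟨ cong (_+ newBoxes x (y ∷ m ∷ [])) (box-∷ y (m ∷ [])) ⟩
  newBoxes y (m ∷ []) + newBoxes x (y ∷ m ∷ [])             ≡⟨ count (adjacent1 (just x) (just y)) (adjacent1 (just y) (just m)) ⟩
  newBoxes x (y ∷ []) + newBoxesʳ (x ∷ y ∷ []) m            ≡⟨ cong (_+ newBoxesʳ (x ∷ y ∷ []) m) (sym (box-∷ x (y ∷ []))) ⟩
  box (x ∷ y ∷ []) + newBoxesʳ (x ∷ y ∷ []) m               ∎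
  where
  open ≡-Reasoning
  count : ∀ a b → (if b then 2 else 0) + (if a then (if b then 1 else 2) else 0)
                  ≡ (if a then 2 else 0) + (if b then (if a then 1 else 2) else 0)
  count true  true  = refl
  count true  false = refl
  count false true  = refl
  count false false = refl
box-∷ʳ (x ∷ y ∷ z ∷ zs) m = begin
  box (x ∷ ys ++ m ∷ [])                                    ≡⟨ box-∷ x (ys ++ m ∷ []) ⟩
  box (ys ++ m ∷ []) + newBoxes x ys                        ≡⟨ cong (_+ newBoxes x ys) (box-∷ʳ (y ∷ z ∷ zs) m) ⟩
  (box ys + newBoxesʳ ys m) + newBoxes x ys                 ≡⟨ +-assoc (box ys) _ _ ⟩
  box ys + (newBoxesʳ ys m + newBoxes x ys)                 ≡⟨ cong (box ys +_) (+-comm (newBoxesʳ ys m) _) ⟩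
  box ys + (newBoxes x ys + newBoxesʳ ys m)                 ≡⟨ sym (+-assoc (box ys) _ _) ⟩
  (box ys + newBoxes x ys) + newBoxesʳ ys m                 ≡⟨ cong (_+ newBoxesʳ ys m) (sym (box-∷ x ys)) ⟩
  box (x ∷ ys) + newBoxesʳ (x ∷ ys) m                       ∎
  where
  open ≡-Reasoning
  ys : List ℕ
  ys = y ∷ z ∷ zs

newBoxesʳ-far : ∀ xs m → adjacent1 (last xs) (just m) ≡ false → newBoxesʳ xs m ≡ 0
newBoxesʳ-far []               m far = refl
newBoxesʳ-far (x ∷ [])         m far rewrite far = refl
newBoxesʳ-far (x ∷ y ∷ [])     m far rewrite far = refl
newBoxesʳ-far (x ∷ y ∷ z ∷ zs) m far = newBoxesʳ-far (y ∷ z ∷ zs) m far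

newBoxesʳ-∷ʳ : ∀ xs y m → newBoxesʳ (xs ++ y ∷ []) m
                          ≡ (if adjacent1 (just y) (just m) then (if adjacent1 (last xs) (just y) then 1 else 2) else 0)
newBoxesʳ-∷ʳ []               y m = refl
newBoxesʳ-∷ʳ (x ∷ [])         y m = refl
newBoxesʳ-∷ʳ (x ∷ x′ ∷ [])    y m = refl
newBoxesʳ-∷ʳ (x ∷ x′ ∷ z ∷ zs) y m = newBoxesʳ-∷ʳ (x′ ∷ z ∷ zs) y m

box-∷ʳ-∷ʳ : ∀ τ x y → box (τ ++ x ∷ y ∷ [])
                      ≡ (box τ + newBoxesʳ τ x) + (if adjacent1 (just x) (just y) then (if adjacent1 (last τ) (just x) then 1 else 2) else 0)
box-∷ʳ-∷ʳ τ x y = trans (cong box (sym (++-assoc τ (x ∷ []) (y ∷ []))))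
  (trans (box-∷ʳ (τ ++ x ∷ []) y) (cong₂ _+_ (box-∷ʳ τ x) (newBoxesʳ-∷ʳ τ x y)))

-- Coefficients and their recurrences

δ : ℕ → ℕ → ℕ
δ a j = if a ≡ᵇ j then 1 else 0

coeff-boxPoly : ∀ L j → coeff (boxPoly L) j ≡ ∑[ σ ∈ L ] δ (box σ) j
coeff-boxPoly []      j = refl
coeff-boxPoly (σ ∷ L) j = trans (coeff-⊕ (xPow (box σ)) (boxPoly L) j) (cong₂ _+_ (coeff-xPow (box σ) j) (coeff-boxPoly L j))
  where
  coeff-⊕ : ∀ p q j → coeff (p ⊕ q) j ≡ coeff p j + coeff q j
  coeff-⊕ []      q       j       = refl
  coeff-⊕ (a ∷ p) []      j       = sym (+-identityʳ _)
  coeff-⊕ (a ∷ p) (b ∷ q) zero    = refl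
  coeff-⊕ (a ∷ p) (b ∷ q) (suc j) = coeff-⊕ p q j
  coeff-xPow : ∀ m j → coeff (xPow m) j ≡ δ m j
  coeff-xPow zero    zero    = refl
  coeff-xPow zero    (suc j) = refl
  coeff-xPow (suc m) zero    = refl
  coeff-xPow (suc m) (suc j) = coeff-xPow m j

-- Apart from coefA, the index n is shifted:
-- coefB n counts σ = (n+1) β, coefC n counts σ = (n+2) (n+1) β, coefE n counts σ = α (n+1)
-- and coefCE n counts σ = α (n+1) (n+2), where α, β range over S_n(132).
coefA coefB coefC coefE coefCE : ℕ → ℕ → ℕ
coefA  n j = ∑[ σ ∈ S132 n ] δ (box σ) j
coefB  n j = ∑[ β ∈ S132 n ] δ (box (suc n ∷ β)) j
coefC  n j = ∑[ β ∈ S132 n ] δ (box (suc (suc n) ∷ suc n ∷ β)) j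
coefE  n j = ∑[ α ∈ S132 n ] δ (box (α ++ suc n ∷ [])) j
coefCE n j = ∑[ α ∈ S132 n ] δ (box (α ++ suc n ∷ suc (suc n) ∷ [])) j

∑around-last : ∀ n f → ∑around n f n 0 ≡ ∑[ α ∈ S132 n ] f (α ++ suc n ∷ [])
∑around-last n f = ∑-cong (S132 n) (λ α → trans (+-identityʳ _) (cong (λ w → f (w ++ suc n ∷ [])) (shift-zero α)))

∑around-cong : ∀ n k l (f g : List ℕ → ℕ) → (∀ τ → f τ ≡ g τ) → ∑around n f k l ≡ ∑around n g k l
∑around-cong n k l f g f≗g = ∑-cong (S132 k) (λ α → ∑-cong (S132 l) (λ β → f≗g _))

convTail-around-cong : ∀ n (f g : List ℕ → ℕ) →
  (∀ k l a α β → suc k + l ≡ n → l + a ≤ n →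
   f ((l + a) ∷ shift l α ++ suc n ∷ β) ≡ g ((l + a) ∷ shift l α ++ suc n ∷ β)) →
  convTail n (∑around n f) ≡ convTail n (∑around n g)
convTail-around-cong n f g f≗g = convTail-cong n (λ k l k+l≡n →
  ∑stacked-cong {λ u v → f (u ++ suc n ∷ v)} {λ u v → g (u ++ suc n ∷ v)} (suc k) l (λ { (a ∷ α) β (a≤k ∷ _) _ _ _ →
    f≗g k l a α β k+l≡n (subst (l + a ≤_) (trans (+-comm l (suc k)) k+l≡n) (+-monoʳ-≤ l a≤k)) }))

convInit-around-cong : ∀ n (f g : List ℕ → ℕ) →
  (∀ k l α b β → k + suc l ≡ n → All (_≤ suc l) (b ∷ β) →
   f (shift (suc l) α ++ suc n ∷ b ∷ β) ≡ g (shift (suc l) α ++ suc n ∷ b ∷ β)) →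
  convInit n (∑around n f) ≡ convInit n (∑around n g)
convInit-around-cong n f g f≗g = convInit-cong n (λ k l k+l≡n →
  ∑stacked-cong {λ u v → f (u ++ suc n ∷ v)} {λ u v → g (u ++ suc n ∷ v)} k (suc l)
    (λ { α (b ∷ β) _ _ bβ≤ _ → f≗g k l α b β k+l≡n bβ≤ }))

convTail-around-zero : ∀ n → convTail n (∑around n (λ _ → 0)) ≡ 0
convTail-around-zero n = trans (convTail-cong n (λ k l _ → ∑stacked-zero (suc k) l)) (convTail-zero n)

convInit-around-zero : ∀ n → convInit n (∑around n (λ _ → 0)) ≡ 0
convInit-around-zero n = trans (convInit-cong n (λ k l _ → ∑stacked-zero k (suc l))) (convInit-zero n)

convTail-around-ext : ∀ n (f g : List ℕ → ℕ) → (∀ τ → f τ ≡ g τ) → convTail n (∑around n f) ≡ convTail n (∑around n g)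
convTail-around-ext n f g f≗g = convTail-cong n (λ k l _ → ∑around-cong n (suc k) l f g f≗g)

convInit-around-ext : ∀ n (f g : List ℕ → ℕ) → (∀ τ → f τ ≡ g τ) → convInit n (∑around n f) ≡ convInit n (∑around n g)
convInit-around-ext n f g f≗g = convInit-cong n (λ k l _ → ∑around-cong n k (suc l) f g f≗g)

coeff-A : ∀ n j → coeff (A n) j ≡ coefA n j
coeff-A n j = coeff-boxPoly (S132 n) j

coeff-B : ∀ n j → coeff (B (suc n)) j ≡ coefB n j
coeff-B n j = begin
  coeff (B (suc n)) j
    ≡⟨ coeff-boxPoly (filter (λ σ → firstIs (suc n) σ Bool.≟ true) (S132 (suc n))) j ⟩
  ∑[ σ ∈ filter (λ σ → firstIs (suc n) σ Bool.≟ true) (S132 (suc n)) ] δ (box σ) j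
    ≡⟨ ∑-filter (λ σ → δ (box σ) j) (firstIs (suc n)) (S132 (suc n)) ⟩
  ∑ g (S132 (suc n))
    ≡⟨ S132-decomposition n g ⟩
  conv n (∑around n g)
    ≡⟨ conv-split-first n (∑around n g) ⟩
  ∑around n g 0 n + convTail n (∑around n g)
    ≡⟨ cong₂ _+_ (cong (_+ 0) (∑-cong (S132 n) (λ β → cong (λ b → if b then δ (box (suc n ∷ β)) j else 0) (≡ᵇ-refl n))))
                 (trans (convTail-around-cong n g (λ _ → 0) (λ k l a α β _ l+a≤n →
                          cong (λ b → if b then δ (box ((l + a) ∷ shift l α ++ suc n ∷ β)) j else 0) (≡ᵇ-< (s≤s l+a≤n))))
                        (convTail-around-zero n)) ⟩
  (coefB n j + 0) + 0
    ≡⟨ trans (+-identityʳ _) (+-identityʳ _) ⟩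
  coefB n j ∎
  where
  open ≡-Reasoning
  g : List ℕ → ℕ
  g σ = if firstIs (suc n) σ then δ (box σ) j else 0
  ≡ᵇ-refl : ∀ n → (n ≡ᵇ n) ≡ true
  ≡ᵇ-refl zero    = refl
  ≡ᵇ-refl (suc n) = ≡ᵇ-refl n
  ≡ᵇ-< : ∀ {a b} → a < b → (a ≡ᵇ b) ≡ false
  ≡ᵇ-< {zero}  {suc b} _         = refl
  ≡ᵇ-< {suc a} {suc b} (s≤s a<b) = ≡ᵇ-< a<b

δ-shift : ∀ c x j → δ (c + x) (c + j) ≡ δ x j
δ-shift zero    x j = refl
δ-shift (suc c) x j = δ-shift c x j

δ-below : ∀ c x {j} → j < c → δ (c + x) j ≡ 0
δ-below (suc c) x {zero}  _         = refl
δ-below (suc c) x {suc j} (s≤s j<c) = δ-below c x j<c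

coefA-first : ∀ m j → coefA (suc m) j ≡ (coefB m j + 0) + convTail m (∑around m (λ τ → δ (box τ) j))
coefA-first m j = trans (S132-decomposition m _) (conv-split-first m _)

coefB-first : ∀ m j → coefB (suc m) j ≡ (coefC m j + 0) + convTail m (∑around m (λ τ → δ (box τ) j))
coefB-first m j = begin
  coefB (suc m) j
    ≡⟨ S132-decomposition m f ⟩
  conv m (∑around m f)
    ≡⟨ conv-split-first m (∑around m f) ⟩
  (coefC m j + 0) + convTail m (∑around m f)
    ≡⟨ cong ((coefC m j + 0) +_) (convTail-around-cong m f (λ τ → δ (box τ) j) (λ k l a α β _ l+a≤m →
         cong (λ x → δ x j) (box-∷-far (2 + m) ((l + a) ∷ shift l α ++ suc m ∷ β)
                                       (adjacent1-far′ (l + a) (2 + m) (s≤s (s≤s l+a≤m)))))) ⟩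
  (coefC m j + 0) + convTail m (∑around m (λ τ → δ (box τ) j)) ∎
  where
  open ≡-Reasoning
  f : List ℕ → ℕ
  f τ = δ (box (2 + m ∷ τ)) j

coefB-rec : ∀ m j → coefB (suc m) j + coefB m j ≡ coefA (suc m) j + coefC m j
coefB-rec m j rewrite coefB-first m j | coefA-first m j =
  solve 3 (λ c b t → (c :+ con 0) :+ t :+ b := (b :+ con 0) :+ t :+ c) refl
          (coefC m j) (coefB m j) (convTail m (∑around m (λ τ → δ (box τ) j)))

coefC-first : ∀ m j → coefC (suc m) j ≡ (∑[ β ∈ S132 m ] δ (1 + box (2 + m ∷ 1 + m ∷ β)) j + 0)
                                        + convTail m (∑around m (λ τ → δ (2 + box τ) j))
coefC-first m j = begin
  coefC (suc m) j
    ≡⟨ S132-decomposition m f ⟩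
  conv m (∑around m f)
    ≡⟨ conv-split-first m (∑around m f) ⟩
  ∑around m f 0 m + convTail m (∑around m f)
    ≡⟨ cong₂ _+_ (cong (_+ 0) (∑-cong (S132 m) (λ β → cong (λ x → δ x j) (one-new β))))
                 (convTail-around-cong m f (λ τ → δ (2 + box τ) j) (λ k l a α β _ l+a≤m →
                   cong (λ x → δ x j) (two-new _ (adjacent1-far′ (l + a) (2 + m) (s≤s (s≤s l+a≤m)))))) ⟩
  (∑[ β ∈ S132 m ] δ (1 + box (2 + m ∷ 1 + m ∷ β)) j + 0) + convTail m (∑around m (λ τ → δ (2 + box τ) j)) ∎
  where
  open ≡-Reasoning
  f : List ℕ → ℕ
  f τ = δ (box (3 + m ∷ 2 + m ∷ τ)) j
  -- m+3 is adjacent to m+2, which is already boxed by m+1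
  one-new : ∀ β → box (3 + m ∷ 2 + m ∷ 1 + m ∷ β) ≡ 1 + box (2 + m ∷ 1 + m ∷ β)
  one-new β rewrite box-∷ (3 + m) (2 + m ∷ 1 + m ∷ β) | adjacent1-suc′ (2 + m) = +-comm _ 1
  -- m+3 and m+2 become boxed; m+2 is not adjacent to the first entry of τ
  two-new : ∀ τ → adjacent1 (just (2 + m)) (at τ 0) ≡ false → box (3 + m ∷ 2 + m ∷ τ) ≡ 2 + box τ
  two-new τ far rewrite box-∷ (3 + m) (2 + m ∷ τ) | box-∷-far (2 + m) τ far | adjacent1-suc′ (2 + m) | far = +-comm _ 2

coefC-suc-0 : ∀ m → coefC (suc m) 0 ≡ 0
coefC-suc-0 m = trans (coefC-first m 0) (cong₂ _+_
  (cong (_+ 0) (trans (∑-cong (S132 m) (λ β → δ-below 1 (box (2 + m ∷ 1 + m ∷ β)) (s≤s z≤n))) (∑-zero (S132 m))))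
  (trans (convTail-around-ext m (λ τ → δ (2 + box τ) 0) (λ _ → 0) (λ τ → δ-below 2 (box τ) (s≤s z≤n))) (convTail-around-zero m)))

coefC-suc-1 : ∀ m → coefC (suc m) 1 ≡ coefC m 0
coefC-suc-1 m = trans (coefC-first m 1) (trans (cong₂ _+_
  (cong (_+ 0) (∑-cong (S132 m) (λ β → δ-shift 1 (box (2 + m ∷ 1 + m ∷ β)) 0)))
  (trans (convTail-around-ext m (λ τ → δ (2 + box τ) 1) (λ _ → 0) (λ τ → δ-below 2 (box τ) (s≤s (s≤s z≤n)))) (convTail-around-zero m)))
  (trans (+-identityʳ _) (+-identityʳ _)))

coefC-rec : ∀ m j → coefC (suc m) (2 + j) + coefB m j ≡ coefC m (1 + j) + coefA (suc m) j
coefC-rec m j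
  rewrite coefC-first m (2 + j) | coefA-first m j
        | ∑-cong (S132 m) (λ β → δ-shift 1 (box (2 + m ∷ 1 + m ∷ β)) (1 + j))
        | convTail-around-ext m (λ τ → δ (2 + box τ) (2 + j)) (λ τ → δ (box τ) j) (λ τ → δ-shift 2 (box τ) j)
  = solve 3 (λ c b t → (c :+ con 0) :+ t :+ b := c :+ ((b :+ con 0) :+ t)) refl
            (coefC m (1 + j)) (coefB m j) (convTail m (∑around m (λ τ → δ (box τ) j)))

coefA-last : ∀ m j → coefA (suc m) j ≡ convInit m (∑around m (λ τ → δ (box τ) j)) + coefE m j
coefA-last m j =
  trans (S132-decomposition m f) (trans (conv-split-last m (∑around m f)) (cong (convInit m (∑around m f) +_) (∑around-last m f)))
  where
  f : List ℕ → ℕ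
  f τ = δ (box τ) j

last-far : ∀ m k l α b β → k + suc l ≡ m → All (_≤ suc l) (b ∷ β) →
           adjacent1 (last (shift (suc l) α ++ suc m ∷ b ∷ β)) (just (2 + m)) ≡ false
last-far m k l α b β k+l≡m bβ≤ =
  trans (cong (λ w → adjacent1 w (just (2 + m))) (last-++ (shift (suc l) α) (suc m) (b ∷ β)))
        (far (b ∷ β) (All.map (λ x≤ → ≤-trans x≤ (subst (suc l ≤_) k+l≡m (m≤n+m (suc l) k))) bβ≤))
  where
  far : ∀ ys → All (_≤ m) ys → adjacent1 (last ys) (just (2 + m)) ≡ false
  far []           []             = refl
  far (y ∷ [])     (y≤m ∷ [])     = adjacent1-far y (2 + m) (s≤s (s≤s y≤m))
  far (y ∷ z ∷ ys) (_ ∷ zys≤m)    = far (z ∷ ys) zys≤m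

coefE-last : ∀ m j → coefE (suc m) j ≡ convInit m (∑around m (λ τ → δ (box τ) j)) + coefCE m j
coefE-last m j = begin
  coefE (suc m) j
    ≡⟨ S132-decomposition m f ⟩
  conv m (∑around m f)
    ≡⟨ conv-split-last m (∑around m f) ⟩
  convInit m (∑around m f) + ∑around m f m 0
    ≡⟨ cong₂ _+_ (convInit-around-cong m f (λ τ → δ (box τ) j) (λ k l α b β k+l≡m bβ≤ →
                   cong (λ x → δ x j) (trans (box-∷ʳ (shift (suc l) α ++ suc m ∷ b ∷ β) (2 + m))
                     (trans (cong (box (shift (suc l) α ++ suc m ∷ b ∷ β) +_)
                                   (newBoxesʳ-far (shift (suc l) α ++ suc m ∷ b ∷ β) (2 + m) (last-far m k l α b β k+l≡m bβ≤)))
                             (+-identityʳ _)))))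
                 (trans (∑around-last m f) (∑-cong (S132 m) (λ α → cong (λ w → δ (box w) j) (++-assoc α (suc m ∷ []) (2 + m ∷ []))))) ⟩
  convInit m (∑around m (λ τ → δ (box τ) j)) + coefCE m j ∎
  where
  open ≡-Reasoning
  f : List ℕ → ℕ
  f τ = δ (box (τ ++ 2 + m ∷ [])) j

coefE-rec : ∀ m j → coefE (suc m) j + coefE m j ≡ coefA (suc m) j + coefCE m j
coefE-rec m j rewrite coefE-last m j | coefA-last m j =
  solve 3 (λ t c e → t :+ c :+ e := t :+ e :+ c) refl (convInit m (∑around m (λ τ → δ (box τ) j))) (coefCE m j) (coefE m j)

coefCE-last : ∀ m j → coefCE (suc m) j ≡ convInit m (∑around m (λ τ → δ (2 + box τ) j))
                                          + ∑[ α ∈ S132 m ] δ (1 + box (α ++ 1 + m ∷ 2 + m ∷ [])) j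
coefCE-last m j = begin
  coefCE (suc m) j
    ≡⟨ S132-decomposition m f ⟩
  conv m (∑around m f)
    ≡⟨ conv-split-last m (∑around m f) ⟩
  convInit m (∑around m f) + ∑around m f m 0
    ≡⟨ cong₂ _+_ (convInit-around-cong m f (λ τ → δ (2 + box τ) j) (λ k l α b β k+l≡m bβ≤ →
                   cong (λ x → δ x j) (two-new (shift (suc l) α ++ suc m ∷ b ∷ β) (last-far m k l α b β k+l≡m bβ≤))))
                 (trans (∑around-last m f) (∑-cong (S132 m) (λ α → cong (λ x → δ x j) (one-new α)))) ⟩
  convInit m (∑around m (λ τ → δ (2 + box τ) j)) + ∑[ α ∈ S132 m ] δ (1 + box (α ++ 1 + m ∷ 2 + m ∷ [])) j ∎
  where
  open ≡-Reasoning
  f : List ℕ → ℕ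
  f τ = δ (box (τ ++ 2 + m ∷ 3 + m ∷ [])) j
  -- m+2 and m+3 become boxed; m+2 is not adjacent to the last entry of τ
  two-new : ∀ τ → adjacent1 (last τ) (just (2 + m)) ≡ false → box (τ ++ 2 + m ∷ 3 + m ∷ []) ≡ 2 + box τ
  two-new τ far rewrite box-∷ʳ-∷ʳ τ (2 + m) (3 + m) | newBoxesʳ-far τ (2 + m) far | adjacent1-suc (2 + m) | far =
    trans (cong (_+ 2) (+-identityʳ (box τ))) (+-comm (box τ) 2)
  -- m+3 is adjacent to m+2, which is already boxed by m+1
  one-new : ∀ α → box ((α ++ 1 + m ∷ []) ++ 2 + m ∷ 3 + m ∷ []) ≡ 1 + box (α ++ 1 + m ∷ 2 + m ∷ [])
  one-new α = begin
    box ((α ++ 1 + m ∷ []) ++ 2 + m ∷ 3 + m ∷ [])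
      ≡⟨ box-∷ʳ-∷ʳ (α ++ 1 + m ∷ []) (2 + m) (3 + m) ⟩
    (box (α ++ 1 + m ∷ []) + newBoxesʳ (α ++ 1 + m ∷ []) (2 + m)) + _
      ≡⟨ cong₂ _+_ (sym (box-∷ʳ (α ++ 1 + m ∷ []) (2 + m))) last-step ⟩
    box ((α ++ 1 + m ∷ []) ++ 2 + m ∷ []) + 1
      ≡⟨ cong (λ w → box w + 1) (++-assoc α (1 + m ∷ []) (2 + m ∷ [])) ⟩
    box (α ++ 1 + m ∷ 2 + m ∷ []) + 1
      ≡⟨ +-comm _ 1 ⟩
    1 + box (α ++ 1 + m ∷ 2 + m ∷ []) ∎
    where
    last-step : (if adjacent1 (just (2 + m)) (just (3 + m)) then (if adjacent1 (last (α ++ 1 + m ∷ [])) (just (2 + m)) then 1 else 2) else 0) ≡ 1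
    last-step rewrite adjacent1-suc (2 + m) | last-++ α (1 + m) [] | adjacent1-suc (1 + m) = refl

coefCE-suc-0 : ∀ m → coefCE (suc m) 0 ≡ 0
coefCE-suc-0 m = trans (coefCE-last m 0) (cong₂ _+_
  (trans (convInit-around-ext m (λ τ → δ (2 + box τ) 0) (λ _ → 0) (λ τ → δ-below 2 (box τ) (s≤s z≤n))) (convInit-around-zero m))
  (trans (∑-cong (S132 m) (λ α → δ-below 1 (box (α ++ 1 + m ∷ 2 + m ∷ [])) (s≤s z≤n))) (∑-zero (S132 m))))

coefCE-suc-1 : ∀ m → coefCE (suc m) 1 ≡ coefCE m 0
coefCE-suc-1 m = trans (coefCE-last m 1) (cong₂ _+_
  (trans (convInit-around-ext m (λ τ → δ (2 + box τ) 1) (λ _ → 0) (λ τ → δ-below 2 (box τ) (s≤s (s≤s z≤n)))) (convInit-around-zero m))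
  (∑-cong (S132 m) (λ α → δ-shift 1 (box (α ++ 1 + m ∷ 2 + m ∷ [])) 0)))

coefCE-rec : ∀ m j → coefCE (suc m) (2 + j) + coefE m j ≡ coefCE m (1 + j) + coefA (suc m) j
coefCE-rec m j
  rewrite coefCE-last m (2 + j) | coefA-last m j
        | ∑-cong (S132 m) (λ α → δ-shift 1 (box (α ++ 1 + m ∷ 2 + m ∷ [])) (1 + j))
        | convInit-around-ext m (λ τ → δ (2 + box τ) (2 + j)) (λ τ → δ (box τ) j) (λ τ → δ-shift 2 (box τ) j)
  = solve 3 (λ t c e → t :+ c :+ e := c :+ (t :+ e)) refl
            (convInit m (∑around m (λ τ → δ (box τ) j))) (coefCE m (1 + j)) (coefE m j)

-- E_n and B_n satisfy the same recurrences (through C and CE) with the same initial values.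
coefE≡coefB×coefCE≡coefC : ∀ m → (∀ j → coefE m j ≡ coefB m j) × (∀ j → coefCE m j ≡ coefC m j)
coefE≡coefB×coefCE≡coefC zero    = (λ j → refl) , (λ j → refl)
coefE≡coefB×coefCE≡coefC (suc m) = e≡b , ce≡c
  where
  ih : (∀ j → coefE m j ≡ coefB m j) × (∀ j → coefCE m j ≡ coefC m j)
  ih = coefE≡coefB×coefCE≡coefC m
  e≡b : ∀ j → coefE (suc m) j ≡ coefB (suc m) j
  e≡b j = +-cancelʳ-≡ (coefB m j) _ _ (begin
    coefE (suc m) j + coefB m j    ≡⟨ cong (coefE (suc m) j +_) (sym (proj₁ ih j)) ⟩
    coefE (suc m) j + coefE m j    ≡⟨ coefE-rec m j ⟩
    coefA (suc m) j + coefCE m j   ≡⟨ cong (coefA (suc m) j +_) (proj₂ ih j) ⟩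
    coefA (suc m) j + coefC m j    ≡⟨ coefB-rec m j ⟨
    coefB (suc m) j + coefB m j    ∎)
    where open ≡-Reasoning
  ce≡c : ∀ j → coefCE (suc m) j ≡ coefC (suc m) j
  ce≡c zero          = trans (coefCE-suc-0 m) (sym (coefC-suc-0 m))
  ce≡c (suc zero)    = trans (coefCE-suc-1 m) (trans (proj₂ ih 0) (sym (coefC-suc-1 m)))
  ce≡c (suc (suc j)) = +-cancelʳ-≡ (coefB m j) _ _ (begin
    coefCE (suc m) (2 + j) + coefB m j   ≡⟨ cong (coefCE (suc m) (2 + j) +_) (sym (proj₁ ih j)) ⟩
    coefCE (suc m) (2 + j) + coefE m j   ≡⟨ coefCE-rec m j ⟩
    coefCE m (1 + j) + coefA (suc m) j   ≡⟨ cong (_+ coefA (suc m) j) (proj₂ ih (1 + j)) ⟩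
    coefC m (1 + j) + coefA (suc m) j    ≡⟨ coefC-rec m j ⟨
    coefC (suc m) (2 + j) + coefB m j    ∎)
    where open ≡-Reasoning

coefE≡coefB : ∀ m j → coefE m j ≡ coefB m j
coefE≡coefB m = proj₁ (coefE≡coefB×coefCE≡coefC m)

δ-+ : ∀ x y j → δ (x + y) j ≡ conv j (λ i i′ → δ x i * δ y i′)
δ-+ zero    y j = sym (begin
  conv j (λ i i′ → δ 0 i * δ y i′)                    ≡⟨ conv-split-first j _ ⟩
  (δ y j + 0) + convTail j (λ i i′ → δ 0 i * δ y i′)  ≡⟨ cong ((δ y j + 0) +_) (trans (convTail-cong j (λ _ _ _ → refl)) (convTail-zero j)) ⟩
  (δ y j + 0) + 0                                     ≡⟨ trans (+-identityʳ _) (+-identityʳ _) ⟩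
  δ y j ∎)
  where open ≡-Reasoning
δ-+ (suc x) y zero    = refl
δ-+ (suc x) y (suc j) = δ-+ x y j

∑-∑-conv : ∀ j (f : X → ℕ → ℕ) (g : Y → ℕ → ℕ) xs ys →
           ∑[ x ∈ xs ] ∑[ y ∈ ys ] conv j (λ i i′ → f x i * g y i′)
           ≡ conv j (λ i i′ → ∑[ x ∈ xs ] f x i * ∑[ y ∈ ys ] g y i′)
∑-∑-conv j f g xs ys =
  trans (∑-cong xs (λ x → trans (∑-conv j (λ y i i′ → f x i * g y i′) ys)
                                (conv-cong j (λ i i′ _ → ∑-*ˡ (f x i) (λ y → g y i′) ys))))
        (trans (∑-conv j (λ x i i′ → f x i * ∑[ y ∈ ys ] g y i′) xs)
               (conv-cong j (λ i i′ _ → ∑-*ʳ (∑[ y ∈ ys ] g y i′) (λ x → f x i) xs)))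

-- When both sides are nonempty, the maximum separates them and the box statistic adds up.
box-middle : ∀ n k l α β → k + l ≡ n → All (_≤ suc l) β →
             box (shift (suc l) α ++ 3 + n ∷ β) ≡ box (α ++ 2 + k ∷ []) + box β
box-middle n k l α β k+l≡n β≤ = begin
  box (shift (suc l) α ++ 3 + n ∷ β)               ≡⟨ cong box (sym (++-assoc (shift (suc l) α) (3 + n ∷ []) β)) ⟩
  box ((shift (suc l) α ++ 3 + n ∷ []) ++ β)       ≡⟨ box-++ (shift (suc l) α ++ 3 + n ∷ []) β far ⟩
  box (shift (suc l) α ++ 3 + n ∷ []) + box β      ≡⟨ cong (λ w → box w + box β) shifted ⟩
  box (shift (suc l) (α ++ 2 + k ∷ [])) + box β    ≡⟨ cong (_+ box β) (box-shift (suc l) (α ++ 2 + k ∷ [])) ⟩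
  box (α ++ 2 + k ∷ []) + box β                    ∎
  where
  open ≡-Reasoning
  shifted : shift (suc l) α ++ 3 + n ∷ [] ≡ shift (suc l) (α ++ 2 + k ∷ [])
  shifted = trans (cong (λ x → shift (suc l) α ++ x ∷ [])
                        (sym (trans (solve 2 (λ k l → con 1 :+ l :+ (con 2 :+ k) := con 3 :+ (k :+ l)) refl k l)
                                    (cong (3 +_) k+l≡n))))
                  (sym (map-++ (suc l +_) α (2 + k ∷ [])))
  far-first : ∀ β → All (_≤ suc l) β → adjacent1 (just (3 + n)) (at β 0) ≡ false
  far-first []      []      = refl
  far-first (b ∷ β) (b≤ ∷ _) = adjacent1-far′ b (3 + n) (s≤s (s≤s (≤-trans b≤ (s≤s (subst (l ≤_) k+l≡n (m≤n+m l k))))))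
  far : adjacent1 (last (shift (suc l) α ++ 3 + n ∷ [])) (at β 0) ≡ false
  far = trans (cong (λ w → adjacent1 w (at β 0)) (last-++ (shift (suc l) α) (3 + n) [])) (far-first β β≤)

coefA-middle : ∀ n j → coefA (3 + n) j ≡ (coefB (2 + n) j + 0)
                                         + (conv n (λ k l → conv j (λ i i′ → coefE (suc k) i * coefA (suc l) i′)) + coefE (2 + n) j)
coefA-middle n j = trans (coefA-first (2 + n) j) (cong ((coefB (2 + n) j + 0) +_)
  (trans (conv-sucʳ n (λ k → ∑around (2 + n) f (suc k)))
         (cong₂ _+_ (conv-cong n middle) (∑around-last (2 + n) f))))
  where
  f : List ℕ → ℕ
  f τ = δ (box τ) j
  middle : ∀ k l → k + l ≡ n → ∑around (2 + n) f (suc k) (suc l) ≡ conv j (λ i i′ → coefE (suc k) i * coefA (suc l) i′)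
  middle k l k+l≡n =
    trans (∑-cong (S132 (suc k)) (λ α → ∑-cong-All (All.map (λ {β} β≤ →
            trans (cong (λ x → δ x j) (box-middle n k l α β k+l≡n β≤)) (δ-+ (box (α ++ 2 + k ∷ [])) (box β) j))
            (S132-bounded (suc l)))))
          (∑-∑-conv j (λ α i → δ (box (α ++ 2 + k ∷ [])) i) (λ β i′ → δ (box β) i′) (S132 (suc k)) (S132 (suc l)))

-- Low degrees

coefC-0 : ∀ n → coefC n 0 ≡ 0
coefC-0 zero    = refl
coefC-0 (suc n) = coefC-suc-0 n

coefC-1 : ∀ n → coefC n 1 ≡ 0
coefC-1 zero    = refl
coefC-1 (suc n) = trans (coefC-suc-1 n) (coefC-0 n)

record NoLowBoxes (n : ℕ) : Set where
  field
    coefB-0 : coefB (suc n) 0 ≡ 0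
    coefB-1 : coefB (suc n) 1 ≡ 0
    coefA-0 : coefA (2 + n) 0 ≡ 0
    coefA-1 : coefA (2 + n) 1 ≡ 0

noLowBoxes : ∀ n → NoLowBoxes n
noLowBoxes = <-rec NoLowBoxes step
  where
  step : ∀ n → (∀ {t} → t < n → NoLowBoxes t) → NoLowBoxes n
  step zero    _  = record { coefB-0 = refl ; coefB-1 = refl ; coefA-0 = refl ; coefA-1 = refl }
  step (suc n) ih = record { coefB-0 = b0 ; coefB-1 = b1 ; coefA-0 = a0 ; coefA-1 = a1 }
    where
    open NoLowBoxes
    prev : NoLowBoxes n
    prev = ih (n<1+n n)
    below : ∀ k l → k + l ≡ n → NoLowBoxes k
    below k l k+l≡n = ih (s≤s (subst (k ≤_) k+l≡n (m≤m+n k l)))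
    b0 : coefB (2 + n) 0 ≡ 0
    b0 = +-cancelʳ-≡ (coefB (1 + n) 0) _ 0 (begin
      coefB (2 + n) 0 + coefB (1 + n) 0  ≡⟨ coefB-rec (1 + n) 0 ⟩
      coefA (2 + n) 0 + coefC (1 + n) 0  ≡⟨ cong₂ _+_ (coefA-0 prev) (coefC-0 (1 + n)) ⟩
      0                                  ≡⟨ sym (coefB-0 prev) ⟩
      coefB (1 + n) 0                    ∎)
      where open ≡-Reasoning
    b1 : coefB (2 + n) 1 ≡ 0
    b1 = +-cancelʳ-≡ (coefB (1 + n) 1) _ 0 (begin
      coefB (2 + n) 1 + coefB (1 + n) 1  ≡⟨ coefB-rec (1 + n) 1 ⟩
      coefA (2 + n) 1 + coefC (1 + n) 1  ≡⟨ cong₂ _+_ (coefA-1 prev) (coefC-1 (1 + n)) ⟩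
      0                                  ≡⟨ sym (coefB-1 prev) ⟩
      coefB (1 + n) 1                    ∎)
      where open ≡-Reasoning
    e0 : ∀ k l → k + l ≡ n → coefE (suc k) 0 ≡ 0
    e0 k l k+l≡n = trans (coefE≡coefB (suc k) 0) (coefB-0 (below k l k+l≡n))
    e1 : ∀ k l → k + l ≡ n → coefE (suc k) 1 ≡ 0
    e1 k l k+l≡n = trans (coefE≡coefB (suc k) 1) (coefB-1 (below k l k+l≡n))
    a0 : coefA (3 + n) 0 ≡ 0
    a0 = trans (coefA-middle n 0) (cong₂ _+_ (cong (_+ 0) b0) (cong₂ _+_
      (trans (conv-cong n (λ k l k+l≡n → cong (_* coefA (suc l) 0) (e0 k l k+l≡n))) (conv-zero n))
      (trans (coefE≡coefB (2 + n) 0) b0)))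
    a1 : coefA (3 + n) 1 ≡ 0
    a1 = trans (coefA-middle n 1) (cong₂ _+_ (cong (_+ 0) b1) (cong₂ _+_
      (trans (conv-cong n (λ k l k+l≡n → cong₂ _+_ (cong (_* coefA (suc l) 1) (e0 k l k+l≡n))
                                                     (cong (_* coefA (suc l) 0) (e1 k l k+l≡n)))) (conv-zero n))
      (trans (coefE≡coefB (2 + n) 1) b1)))

open NoLowBoxes

coefA-suc-1 : ∀ l → coefA (suc l) 1 ≡ 0
coefA-suc-1 zero    = refl
coefA-suc-1 (suc l) = coefA-1 (noLowBoxes l)

coefE-suc-0 : ∀ k → coefE (suc k) 0 ≡ 0
coefE-suc-0 k = trans (coefE≡coefB (suc k) 0) (coefB-0 (noLowBoxes k))

coefE-suc-1 : ∀ k → coefE (suc k) 1 ≡ 0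
coefE-suc-1 k = trans (coefE≡coefB (suc k) 1) (coefB-1 (noLowBoxes k))

coefC-suc-2 : ∀ n → coefC (suc n) 2 ≡ 0
coefC-suc-2 zero    = refl
coefC-suc-2 (suc n) = +-cancelʳ-≡ (coefB (suc n) 0) _ 0 (begin
  coefC (2 + n) 2 + coefB (suc n) 0    ≡⟨ coefC-rec (suc n) 0 ⟩
  coefC (suc n) 1 + coefA (2 + n) 0    ≡⟨ cong₂ _+_ (coefC-1 (suc n)) (coefA-0 (noLowBoxes n)) ⟩
  0                                    ≡⟨ sym (coefB-0 (noLowBoxes n)) ⟩
  coefB (suc n) 0                      ∎)
  where open ≡-Reasoning

record DegreeTwo (n : ℕ) : Set where
  field
    coefB-2 : coefB (suc n) 2 ≡ F n
    coefA-2 : coefA (2 + n) 2 ≡ F (2 + n)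

degreeTwo : ∀ n → DegreeTwo n
degreeTwo = <-rec DegreeTwo step
  where
  step : ∀ n → (∀ {t} → t < n → DegreeTwo t) → DegreeTwo n
  step zero    _  = record { coefB-2 = refl ; coefA-2 = refl }
  step (suc n) ih = record { coefB-2 = b2 ; coefA-2 = a2 }
    where
    open DegreeTwo
    open ≡-Reasoning
    prev : DegreeTwo n
    prev = ih (n<1+n n)
    b2 : coefB (2 + n) 2 ≡ F (suc n)
    b2 = +-cancelʳ-≡ (F n) _ _ (begin
      coefB (2 + n) 2 + F n              ≡⟨ cong (coefB (2 + n) 2 +_) (sym (coefB-2 prev)) ⟩
      coefB (2 + n) 2 + coefB (1 + n) 2  ≡⟨ coefB-rec (1 + n) 2 ⟩
      coefA (2 + n) 2 + coefC (1 + n) 2  ≡⟨ cong₂ _+_ (coefA-2 prev) (coefC-suc-2 n) ⟩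
      F (2 + n) + 0                      ≡⟨ +-identityʳ _ ⟩
      F (1 + n) + F n                    ∎)
    -- only the products coefE (k+1) 2 * coefA (l+1) 0 survive, and coefA (l+1) 0 = 0 unless l = 0
    inner : ∀ k l → k + l ≡ n → conv 2 (λ i i′ → coefE (suc k) i * coefA (suc l) i′) ≡ F k * coefA (suc l) 0
    inner k l k+l≡n
      rewrite coefE-suc-0 k | coefE-suc-1 k | coefE≡coefB (suc k) 2
            | coefB-2 (ih (s≤s (subst (k ≤_) k+l≡n (m≤m+n k l)))) = refl
    outer : conv n (λ k l → F k * coefA (suc l) 0) ≡ F n
    outer = begin
      conv n (λ k l → F k * coefA (suc l) 0)
        ≡⟨ conv-split-last n _ ⟩
      convInit n (λ k l → F k * coefA (suc l) 0) + F n * 1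
        ≡⟨ cong₂ _+_ (trans (convInit-cong n (λ k l _ → trans (cong (F k *_) (coefA-0 (noLowBoxes l))) (*-zeroʳ (F k))))
                            (convInit-zero n))
                     (*-identityʳ (F n)) ⟩
      F n ∎
    a2 : coefA (3 + n) 2 ≡ F (3 + n)
    a2 = begin
      coefA (3 + n) 2
        ≡⟨ coefA-middle n 2 ⟩
      (coefB (2 + n) 2 + 0) + (conv n (λ k l → conv 2 (λ i i′ → coefE (suc k) i * coefA (suc l) i′)) + coefE (2 + n) 2)
        ≡⟨ cong₂ _+_ (cong (_+ 0) b2) (cong₂ _+_ (trans (conv-cong n inner) outer) (trans (coefE≡coefB (2 + n) 2) b2)) ⟩
      (F (1 + n) + 0) + (F n + F (1 + n))
        ≡⟨ solve 2 (λ a b → (a :+ con 0) :+ (b :+ a) := (a :+ b) :+ a) refl (F (1 + n)) (F n) ⟩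
      F (3 + n) ∎

open DegreeTwo

coefC-suc-3 : ∀ n → coefC (2 + n) 3 ≡ 0
coefC-suc-3 n = +-cancelʳ-≡ (coefB (suc n) 1) _ 0 (begin
  coefC (2 + n) 3 + coefB (suc n) 1   ≡⟨ coefC-rec (suc n) 1 ⟩
  coefC (suc n) 2 + coefA (2 + n) 1   ≡⟨ cong₂ _+_ (coefC-suc-2 n) (coefA-1 (noLowBoxes n)) ⟩
  0                                   ≡⟨ sym (coefB-1 (noLowBoxes n)) ⟩
  coefB (suc n) 1                     ∎)
  where open ≡-Reasoning

coefC-suc-4 : ∀ t → coefC (3 + t) 4 ≡ F (2 + t)
coefC-suc-4 t = +-cancelʳ-≡ (F (1 + t)) _ _ (begin
  coefC (3 + t) 4 + F (1 + t)             ≡⟨ cong (coefC (3 + t) 4 +_) (sym (coefB-2 (degreeTwo (1 + t)))) ⟩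
  coefC (3 + t) 4 + coefB (2 + t) 2       ≡⟨ coefC-rec (2 + t) 2 ⟩
  coefC (2 + t) 3 + coefA (3 + t) 2       ≡⟨ cong₂ _+_ (coefC-suc-3 t) (coefA-2 (degreeTwo (1 + t))) ⟩
  F (3 + t)                               ∎)
  where open ≡-Reasoning

-- Degree four

fibConv : ℕ → ℕ
fibConv t = conv t (λ k l → F k * F (2 + l))

coefA-4 : ∀ t → coefA (4 + t) 4 ≡ 2 * coefB (3 + t) 4 + coefB (2 + t) 4 + fibConv t
coefA-4 t = begin
  coefA (4 + t) 4
    ≡⟨ coefA-middle (suc t) 4 ⟩
  (coefB (3 + t) 4 + 0) + (conv (suc t) (λ k l → conv 4 (λ i i′ → coefE (suc k) i * coefA (suc l) i′)) + coefE (3 + t) 4)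
    ≡⟨ cong (λ s → (coefB (3 + t) 4 + 0) + (s + coefE (3 + t) 4))
            (trans (conv-cong (suc t) (λ k l _ → inner k l))
                   (trans (conv-sucʳ t term) (cong₂ _+_ (conv-cong t (λ k l _ → middle k l)) final))) ⟩
  (coefB (3 + t) 4 + 0) + ((fibConv t + coefB (2 + t) 4) + coefE (3 + t) 4)
    ≡⟨ cong (λ e → (coefB (3 + t) 4 + 0) + ((fibConv t + coefB (2 + t) 4) + e)) (coefE≡coefB (3 + t) 4) ⟩
  (coefB (3 + t) 4 + 0) + ((fibConv t + coefB (2 + t) 4) + coefB (3 + t) 4)
    ≡⟨ solve 3 (λ b₃ b₂ c → (b₃ :+ con 0) :+ ((c :+ b₂) :+ b₃) := con 2 :* b₃ :+ b₂ :+ c) refl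
             (coefB (3 + t) 4) (coefB (2 + t) 4) (fibConv t) ⟩
  2 * coefB (3 + t) 4 + coefB (2 + t) 4 + fibConv t ∎
  where
  open ≡-Reasoning
  -- coefE (k+1) i vanishes for i < 2 and coefA (l+1) 1 = 0, leaving i = 2 and i = 4
  term : ℕ → ℕ → ℕ
  term k l = F k * coefA (suc l) 2 + coefB (suc k) 4 * coefA (suc l) 0
  inner : ∀ k l → conv 4 (λ i i′ → coefE (suc k) i * coefA (suc l) i′) ≡ term k l
  inner k l
    rewrite coefE-suc-0 k | coefE-suc-1 k | coefA-suc-1 l | coefE≡coefB (suc k) 2
          | coefB-2 (degreeTwo k) | coefE≡coefB (suc k) 4 | *-zeroʳ (coefE (suc k) 3)
    = refl
  middle : ∀ k l → term k (suc l) ≡ F k * F (2 + l)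
  middle k l rewrite coefA-2 (degreeTwo l) | coefA-0 (noLowBoxes l) | *-zeroʳ (coefB (suc k) 4) = +-identityʳ _
  final : term (suc t) 0 ≡ coefB (2 + t) 4
  final rewrite *-zeroʳ (F (suc t)) = *-identityʳ _

coefB-4 : ∀ t → coefB (5 + t) 4 ≡ coefB (4 + t) 4 + coefB (3 + t) 4 + (fibConv (suc t) + F (3 + t))
coefB-4 t = +-cancelʳ-≡ (coefB (4 + t) 4) _ _ (begin
  coefB (5 + t) 4 + coefB (4 + t) 4
    ≡⟨ coefB-rec (4 + t) 4 ⟩
  coefA (5 + t) 4 + coefC (4 + t) 4
    ≡⟨ cong₂ _+_ (coefA-4 (suc t)) (coefC-suc-4 (suc t)) ⟩
  (2 * coefB (4 + t) 4 + coefB (3 + t) 4 + fibConv (suc t)) + F (3 + t)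
    ≡⟨ solve 4 (λ b₄ b₃ c f → (con 2 :* b₄ :+ b₃ :+ c) :+ f := (b₄ :+ b₃ :+ (c :+ f)) :+ b₄) refl
             (coefB (4 + t) 4) (coefB (3 + t) 4) (fibConv (suc t)) (F (3 + t)) ⟩
  (coefB (4 + t) 4 + coefB (3 + t) 4 + (fibConv (suc t) + F (3 + t))) + coefB (4 + t) 4 ∎)
  where open ≡-Reasoning

conv≡sum : ∀ t (G : ℕ → ℕ → ℕ) (g : ℕ → ℕ) → (∀ k l → k + l ≡ t → G k l ≡ g k) →
           conv t G ≡ sum (map g (upTo (suc t)))
conv≡sum zero    G g G≗g = trans (G≗g 0 0 refl) (sym (+-identityʳ (g 0)))
conv≡sum (suc t) G g G≗g =
  trans (cong₂ _+_ (G≗g 0 (suc t) refl) (conv≡sum t (G ∘ suc) (g ∘ suc) (λ k l k+l≡t → G≗g (suc k) l (cong suc k+l≡t))))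
        (cong (λ xs → g 0 + sum xs) (trans (map-applyUpTo id (g ∘ suc) (suc t)) (sym (map-applyUpTo suc g (suc t)))))

2+t∸k : ∀ k l t → k + l ≡ t → (2 + t) ∸ k ≡ 2 + l
2+t∸k zero    l t       refl = refl
2+t∸k (suc k) l (suc t) k+l≡t = 2+t∸k k l t (suc-injective k+l≡t)

fibConv≡sum : ∀ t → fibConv t ≡ sum (map (λ k → F k * F ((2 + t) ∸ k)) (upTo (suc t)))
fibConv≡sum t = conv≡sum t (λ k l → F k * F (2 + l)) (λ k → F k * F ((2 + t) ∸ k)) (λ k l k+l≡t → cong (λ x → F k * F x) (sym (2+t∸k k l t k+l≡t)))

-- the Fibonacci recurrence absorbs the two leading terms of fibConv (t+1)
fibConv-suc : ∀ t → fibConv (suc t) + F (3 + t) ≡ F (5 + t) + sum (map (λ k → F (2 + k) * F ((1 + t) ∸ k)) (upTo t))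
fibConv-suc zero    = refl
fibConv-suc (suc t) = trans
  (solve 3 (λ a b c → (con 1 :* a :+ (con 1 :* b :+ c)) :+ a := ((a :+ b) :+ a) :+ c) refl
         (F (4 + t)) (F (3 + t)) (conv t (λ k l → F (2 + k) * F (2 + l))))
  (cong (F (6 + t) +_) (conv≡sum t (λ k l → F (2 + k) * F (2 + l)) (λ k → F (2 + k) * F ((2 + t) ∸ k)) (λ k l k+l≡t →
    cong (λ x → F (2 + k) * F x) (sym (2+t∸k k l t k+l≡t)))))

small-cases : (n : ℕ) → 1 ≤ n → n ≤ 3 → (coeff (A n) 4 ≡ 0) × (coeff (B n) 4 ≡ 0) × (coeff (E n) 4 ≡ 0)
small-cases 1 _ _ = refl , refl , refl
small-cases 2 _ _ = refl , refl , refl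
small-cases 3 _ _ = refl , refl , refl
small-cases (suc (suc (suc (suc n)))) _ (s≤s (s≤s (s≤s ())))

A-recurrence : (n : ℕ) → 4 ≤ n →
               coeff (A n) 4 ≡ 2 * coeff (B n) 4 + coeff (B (n ∸ 1)) 4 + sumFromTo 2 (n ∸ 2) (λ i → F (i ∸ 2) * F (n ∸ i))
A-recurrence (suc (suc (suc (suc t)))) (s≤s (s≤s (s≤s (s≤s z≤n)))) = begin
  coeff (A (4 + t)) 4
    ≡⟨ coeff-A (4 + t) 4 ⟩
  coefA (4 + t) 4
    ≡⟨ coefA-4 t ⟩
  2 * coefB (3 + t) 4 + coefB (2 + t) 4 + fibConv t
    ≡⟨ cong₂ _+_ (cong₂ (λ b₃ b₂ → 2 * b₃ + b₂) (sym (coeff-B (3 + t) 4)) (sym (coeff-B (2 + t) 4))) (fibConv≡sum t) ⟩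
  2 * coeff (B (4 + t)) 4 + coeff (B (3 + t)) 4 + sum (map (λ k → F k * F ((2 + t) ∸ k)) (upTo (suc t))) ∎
  where open ≡-Reasoning

B-recurrence : (n : ℕ) → 6 ≤ n →
               coeff (B n) 4 ≡ coeff (B (n ∸ 1)) 4 + coeff (B (n ∸ 2)) 4 + F (n ∸ 1)
                               + sumFromTo 4 (n ∸ 3) (λ i → F (i ∸ 2) * F (n ∸ 1 ∸ i))
B-recurrence (suc (suc (suc (suc (suc (suc t)))))) (s≤s (s≤s (s≤s (s≤s (s≤s (s≤s z≤n)))))) = begin
  coeff (B (6 + t)) 4
    ≡⟨ coeff-B (5 + t) 4 ⟩
  coefB (5 + t) 4
    ≡⟨ coefB-4 t ⟩
  coefB (4 + t) 4 + coefB (3 + t) 4 + (fibConv (suc t) + F (3 + t))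
    ≡⟨ cong (coefB (4 + t) 4 + coefB (3 + t) 4 +_) (fibConv-suc t) ⟩
  coefB (4 + t) 4 + coefB (3 + t) 4 + (F (5 + t) + rest)
    ≡⟨ sym (+-assoc (coefB (4 + t) 4 + coefB (3 + t) 4) (F (5 + t)) rest) ⟩
  coefB (4 + t) 4 + coefB (3 + t) 4 + F (5 + t) + rest
    ≡⟨ cong (λ s → s + F (5 + t) + rest) (sym (cong₂ _+_ (coeff-B (4 + t) 4) (coeff-B (3 + t) 4))) ⟩
  coeff (B (5 + t)) 4 + coeff (B (4 + t)) 4 + F (5 + t) + rest ∎
  where
  open ≡-Reasoning
  rest : ℕ
  rest = sum (map (λ k → F (2 + k) * F ((1 + t) ∸ k)) (upTo t))

theorem5 :
    ((n : ℕ) → 1 ≤ n → n ≤ 3 →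
      (coeff (A n) 4 ≡ 0) × (coeff (B n) 4 ≡ 0) × (coeff (E n) 4 ≡ 0))
    × (coeff (B 4) 4 ≡ 2)
    × (coeff (B 5) 4 ≡ 6)
    × ((n : ℕ) → 4 ≤ n →
        coeff (A n) 4 ≡ 2 * coeff (B n) 4 + coeff (B (n ∸ 1)) 4
                        + sumFromTo 2 (n ∸ 2) (λ i → F (i ∸ 2) * F (n ∸ i)))
    × ((n : ℕ) → 6 ≤ n →
        coeff (B n) 4 ≡ coeff (B (n ∸ 1)) 4 + coeff (B (n ∸ 2)) 4 + F (n ∸ 1)
                        + sumFromTo 4 (n ∸ 3) (λ i → F (i ∸ 2) * F (n ∸ 1 ∸ i)))
theorem5 = small-cases , refl , refl , A-recurrence , B-recurrence
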